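{- For a positive integer $d$, let $N(d)$ be the number of distinct characteristics of non-degenerate triangles with integral side lengths whose largest side length equals $d$. Then $N(d)\in O(d^2)$ and $N(d)\in\Omega\!\left(\frac{d^2}{(\log d)^2}\right)$.
   Context: For a non-degenerate triangle with integral side lengths $a,b,c$, by Heron's formula its area is $\frac14\sqrt{(a+b+c)(a+b-c)(a-b+c)(-a+b+c)}$, which can be written uniquely as $q\sqrt{k}$ with $q$ a positive rational number and $k$ a squarefree positive integer; $k$ (the squarefree part of $(a+b+c)(a+b-c)(a-b+c)(-a+b+c)$) is called the characteristic of the triangle. -}

module Defs where

open import Data.Nat using (ℕ; _+_; _*_; _∸_; _<_; _≤_; _⊔_)
open import Data.Nat.Divisibility using (_∣_)
open import Data.Product using (Σ; ∃; ∃-syntax; _×_)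
open import Data.List using (List)
open import Data.List.Membership.Propositional using (_∈_)
open import Data.List.Relation.Unary.Unique.Propositional using (Unique)
open import Function.Bundles using (_⇔_)
open import Relation.Binary.PropositionalEquality using (_≡_)

-- non-degenerate triangle with integral side lengths a, b, c
-- (strict triangle inequalities; these force a, b, c ≥ 1)
NonDegTriangle : ℕ → ℕ → ℕ → Set
NonDegTriangle a b c = (c < a + b) × (b < a + c) × (a < b + c)

-- (a+b+c)(a+b-c)(a-b+c)(-a+b+c); truncated subtraction is exact
-- for non-degenerate triangles
heron : ℕ → ℕ → ℕ → ℕ
heron a b c = (a + b + c) * ((a + b) ∸ c) * ((a + c) ∸ b) * ((b + c) ∸ a)

Squarefree : ℕ → Set
Squarefree k = (1 ≤ k) × (∀ m → m * m ∣ k → m ≡ 1)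

IsSquarefreePart : ℕ → ℕ → Set
IsSquarefreePart n k = Squarefree k × ∃[ m ] (n ≡ k * (m * m))

IsCharacteristic : ℕ → ℕ → ℕ → ℕ → Set
IsCharacteristic a b c k = IsSquarefreePart (heron a b c) k

IsCharOfLargest : ℕ → ℕ → Set
IsCharOfLargest d k =
  ∃[ a ] ∃[ b ] ∃[ c ] (NonDegTriangle a b c × (a ⊔ b ⊔ c ≡ d) × IsCharacteristic a b c k)

-- L is a duplicate-free enumeration of all characteristics of
-- triangles with largest side d; N(d) = length L
EnumeratesChars : ℕ → List ℕ → Set
EnumeratesChars d L = Unique L × (∀ k → (k ∈ L) ⇔ IsCharOfLargest d k)

module Submission where

open import Defs
open import Data.Nat
open import Data.Nat.Properties
open import Data.Nat.Divisibility
open import Data.Nat.DivMod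
open import Data.Nat.GCD using (gcd; gcd[m,n]∣m; gcd[m,n]∣n; gcd[m,n]≢0)
open import Data.Nat.Coprimality as Coprime using (Coprime; coprime-/gcd; coprime-divisor)
open import Data.Nat.Primality
open import Data.Nat.Primality.Factorisation
open import Data.Nat.Logarithm
open import Data.Nat.ListAction using (product)
open import Data.Nat.ListAction.Properties using (product-++; ∈⇒∣product)
open import Data.Nat.Tactic.RingSolver using (solve-∀)
open import Data.Bool using (T; true; false; if_then_else_)
open import Data.List
  using (List; []; _∷_; _++_; length; map; filter; upTo; cartesianProduct)
open import Data.List.Properties using (length-++; length-map; length-upTo; filter-++)
open import Data.List.Relation.Unary.All as All using (All; []; _∷_)
open import Data.List.Relation.Unary.All.Properties using (++⁺)
open import Data.List.Relation.Unary.Any using (here; there)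
open import Data.List.Membership.Propositional using (_∈_)
open import Data.List.Membership.Propositional.Properties
  using (∈-∃++; ∈-++⁻; ∈-++⁺ˡ; ∈-++⁺ʳ; ∈-map⁺; ∈-upTo⁺; ∈-filter⁻;
         ∈-cartesianProduct⁺; ∈-cartesianProduct⁻)
open import Data.List.Relation.Unary.Unique.Propositional using (Unique)
open import Data.List.Relation.Unary.AllPairs using ([]; _∷_)
import Data.List.Relation.Unary.Unique.Propositional.Properties as Unique
open import Data.List.Relation.Binary.Permutation.Propositional as ↭ using (_↭_)
open import Data.Product using (Σ; ∃-syntax; _×_; _,_; proj₁; proj₂)
open import Data.Sum using (_⊎_; inj₁; inj₂)
open import Data.Empty using (⊥-elim)
open import Function.Base using (_∘_)
open import Function.Bundles using (Equivalence)
open import Relation.Nullary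
open import Relation.Nullary.Decidable using (_×-dec_; decidable-stable)
open import Relation.Binary.Definitions using (tri<; tri≈; tri>)
open import Relation.Binary.PropositionalEquality

-- Upper bound: a triangle determines its characteristic, and there are at most 3(d + 1)² triples
-- of sides with largest side d.
--
-- Lower bound: take n ≈ d/128 and the primes S in (n, 32n].  For lo < hi in S the triangle
-- (d, d − (hi − lo)/2, (lo + hi)/2) has Heron product (2d + lo)(2d − hi)·hi·lo, so for most pairs
-- both lo and hi divide its characteristic exactly once.  Any other prime of S dividing that
-- characteristic divides 2d + lo or 2d − hi, numbers below 600n, which leaves O(1) candidates for
-- the pair: the characteristics are at least a constant times |S|².  Chebyshev's bound
-- |S| ≫ n / log n, obtained from the central binomial coefficient through Legendre's formula and
-- Kummer's bound on carries, gives N(d) ≫ d² / (log d)².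

-- binom a b = (a + b) choose a, indexed so that Pascal's rule is structural recursion.
binom : ℕ → ℕ → ℕ
binom zero    b       = 1
binom (suc a) zero    = 1
binom (suc a) (suc b) = binom a (suc b) + binom (suc a) b

binom*a!*b!≡[a+b]! : ∀ a b → binom a b * a ! * b ! ≡ (a + b) !
binom*a!*b!≡[a+b]! zero    b    = +-identityʳ (b !)
binom*a!*b!≡[a+b]! (suc a) zero = begin
  1 * suc a ! * 1  ≡⟨ trans (*-identityʳ _) (*-identityˡ _) ⟩
  suc a !          ≡⟨ cong _! (+-identityʳ (suc a)) ⟨
  (suc a + 0) !    ∎
  where open ≡-Reasoning
binom*a!*b!≡[a+b]! (suc a) (suc b) = begin
    (binom a (suc b) + binom (suc a) b) * (suc a * a !) * (suc b * b !)
  ≡⟨ pascal-step (binom a (suc b)) (binom (suc a) b) a b (a !) (b !) ⟩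
    suc a * (binom a (suc b) * a ! * (suc b * b !)) + suc b * (binom (suc a) b * (suc a * a !) * b !)
  ≡⟨ cong₂ (λ u v → suc a * u + suc b * v) (binom*a!*b!≡[a+b]! a (suc b)) (binom*a!*b!≡[a+b]! (suc a) b) ⟩
    suc a * (a + suc b) ! + suc b * (suc a + b) !
  ≡⟨ cong (λ t → suc a * t ! + suc b * (suc a + b) !) (+-suc a b) ⟩
    suc a * (suc a + b) ! + suc b * (suc a + b) !
  ≡⟨ *-distribʳ-+ ((suc a + b) !) (suc a) (suc b) ⟨
    (suc a + suc b) * (suc a + b) !
  ≡⟨ cong (λ t → t * (suc a + b) !) (+-suc (suc a) b) ⟩
    suc (suc a + b) * (suc a + b) !
  ≡⟨ cong _! (+-suc (suc a) b) ⟨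
    (suc a + suc b) !
  ∎
  where
  open ≡-Reasoning
  pascal-step : ∀ x y a b A B → (x + y) * (suc a * A) * (suc b * B)
                              ≡ suc a * (x * A * (suc b * B)) + suc b * (y * (suc a * A) * B)
  pascal-step = solve-∀

binom-sym : ∀ a b → binom a b ≡ binom b a
binom-sym zero    zero    = refl
binom-sym zero    (suc b) = refl
binom-sym (suc a) zero    = refl
binom-sym (suc a) (suc b) =
  trans (cong₂ _+_ (binom-sym a (suc b)) (binom-sym (suc a) b)) (+-comm (binom (suc b) a) _)

binom>0 : ∀ a b → 0 < binom a b
binom>0 zero    b       = ≤-refl
binom>0 (suc a) zero    = ≤-refl
binom>0 (suc a) (suc b) = ≤-trans (binom>0 a (suc b)) (m≤m+n _ _)

binom≤2^[a+b] : ∀ a b → binom a b ≤ 2 ^ (a + b)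
binom≤2^[a+b] zero    b       = m^n>0 2 b
binom≤2^[a+b] (suc a) zero    = m^n>0 2 (suc a + 0)
binom≤2^[a+b] (suc a) (suc b) = begin
    binom a (suc b) + binom (suc a) b
  ≤⟨ +-mono-≤ (binom≤2^[a+b] a (suc b)) (binom≤2^[a+b] (suc a) b) ⟩
    2 ^ (a + suc b) + 2 ^ (suc a + b)
  ≡⟨ cong (λ t → 2 ^ t + 2 ^ (suc a + b)) (+-suc a b) ⟩
    2 ^ (suc a + b) + 2 ^ (suc a + b)
  ≡⟨ cong (2 ^ (suc a + b) +_) (+-identityʳ _) ⟨
    2 ^ suc (suc a + b)
  ≡⟨ cong (2 ^_) (+-suc (suc a) b) ⟨
    2 ^ (suc a + suc b)
  ∎
  where open ≤-Reasoning

binom-monoˡ : ∀ a b → binom a b ≤ binom (suc a) b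
binom-monoˡ zero    zero    = ≤-refl
binom-monoˡ zero    (suc b) = m≤m+n 1 (binom 1 b)
binom-monoˡ (suc a) zero    = ≤-refl
binom-monoˡ (suc a) (suc b) = m≤m+n (binom (suc a) (suc b)) (binom (suc (suc a)) b)

2^m≤binom[m,m] : ∀ m → 2 ^ m ≤ binom m m
2^m≤binom[m,m] zero    = ≤-refl
2^m≤binom[m,m] (suc m) = begin
    2 * 2 ^ m
  ≤⟨ *-monoʳ-≤ 2 (≤-trans (2^m≤binom[m,m] m) (binom-monoˡ m m)) ⟩
    2 * binom (suc m) m
  ≡⟨ cong₂ _+_ (binom-sym (suc m) m) (+-identityʳ _) ⟩
    binom m (suc m) + binom (suc m) m
  ∎
  where open ≤-Reasoning

δ : ℕ → ℕ → ℕ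
δ x p = if x ≡ᵇ p then 1 else 0

δ-refl : ∀ p → δ p p ≡ 1
δ-refl zero    = refl
δ-refl (suc p) = δ-refl p

multiplicity : ℕ → List ℕ → ℕ
multiplicity p []       = 0
multiplicity p (x ∷ xs) = δ x p + multiplicity p xs

multiplicity-++ : ∀ p xs ys → multiplicity p (xs ++ ys) ≡ multiplicity p xs + multiplicity p ys
multiplicity-++ p []       ys = refl
multiplicity-++ p (x ∷ xs) ys =
  trans (cong (δ x p +_) (multiplicity-++ p xs ys)) (sym (+-assoc (δ x p) _ _))

multiplicity-↭ : ∀ p {xs ys} → xs ↭ ys → multiplicity p xs ≡ multiplicity p ys
multiplicity-↭ p ↭.refl         = refl
multiplicity-↭ p (↭.prep x r)   = cong (δ x p +_) (multiplicity-↭ p r)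
multiplicity-↭ p (↭.swap x y r) = begin
  δ x p + (δ y p + _)  ≡⟨ +-assoc (δ x p) (δ y p) _ ⟨
  δ x p + δ y p + _    ≡⟨ cong₂ _+_ (+-comm (δ x p) (δ y p)) (multiplicity-↭ p r) ⟩
  δ y p + δ x p + _    ≡⟨ +-assoc (δ y p) (δ x p) _ ⟩
  δ y p + (δ x p + _)  ∎
  where open ≡-Reasoning
multiplicity-↭ p (↭.trans r s)  = trans (multiplicity-↭ p r) (multiplicity-↭ p s)

multiplicity>0⇒∈ : ∀ p xs → 0 < multiplicity p xs → p ∈ xs
multiplicity>0⇒∈ p (x ∷ xs) h with x ≡ᵇ p in eq
... | true  = here (sym (≡ᵇ⇒≡ x p (subst T (sym eq) _)))
... | false = there (multiplicity>0⇒∈ p xs h)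

∈⇒multiplicity>0 : ∀ {p xs} → p ∈ xs → 0 < multiplicity p xs
∈⇒multiplicity>0 {p} {x ∷ xs} (here refl) =
  subst (λ t → 0 < t + multiplicity x xs) (sym (δ-refl x)) (s≤s z≤n)
∈⇒multiplicity>0 {p} {x ∷ xs} (there m)   =
  ≤-trans (∈⇒multiplicity>0 m) (m≤n+m _ (δ x p))

prime>0 : ∀ {q} → Prime q → 0 < q
prime>0 {q} q-prime = n≢0⇒n>0 (≢-nonZero⁻¹ q {{prime⇒nonZero q-prime}})

-- The p-adic valuation, read off the canonical factorisation; ν p 0 = 0 is a junk value.
ν : ℕ → ℕ → ℕ
ν p zero    = 0
ν p (suc n) = multiplicity p (factors (factorise (suc n)))

ν≡multiplicity : ∀ p N xs → All Prime xs → N ≡ product xs → ν p N ≡ multiplicity p xs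
ν≡multiplicity p zero    xs ps eq = ⊥-elim (<⇒≢ (productOfPrimes≥1 ps) eq)
ν≡multiplicity p (suc N) xs ps eq = multiplicity-↭ p (factorisationUnique (factorise (suc N)) f)
  where
  f : PrimeFactorisation (suc N)
  f = record { factors = xs ; isFactorisation = eq ; factorsPrime = ps }

primeFactors : ∀ N → 0 < N → Σ (List ℕ) λ xs → All Prime xs × N ≡ product xs
primeFactors (suc N) _ = factors f , factorsPrime f , isFactorisation f
  where
  f = factorise (suc N)
  open PrimeFactorisation

ν-* : ∀ p a b → 0 < a → 0 < b → ν p (a * b) ≡ ν p a + ν p b
ν-* p a b a>0 b>0 with primeFactors a a>0 | primeFactors b b>0
... | xs , xs-prime , a≡ | ys , ys-prime , b≡ = begin
    ν p (a * b)
  ≡⟨ ν≡multiplicity p (a * b) (xs ++ ys) (++⁺ xs-prime ys-prime)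
       (trans (cong₂ _*_ a≡ b≡) (sym (product-++ xs ys))) ⟩
    multiplicity p (xs ++ ys)
  ≡⟨ multiplicity-++ p xs ys ⟩
    multiplicity p xs + multiplicity p ys
  ≡⟨ cong₂ _+_ (ν≡multiplicity p a xs xs-prime a≡) (ν≡multiplicity p b ys ys-prime b≡) ⟨
    ν p a + ν p b
  ∎
  where open ≡-Reasoning

ν[p,p]≡1 : ∀ p → Prime p → ν p p ≡ 1
ν[p,p]≡1 p p-prime =
  trans (ν≡multiplicity p p (p ∷ []) (p-prime ∷ []) (sym (*-identityʳ p))) (cong (_+ 0) (δ-refl p))

ν[p,p*m]≡1+ν[p,m] : ∀ p m → Prime p → 0 < m → ν p (p * m) ≡ suc (ν p m)
ν[p,p*m]≡1+ν[p,m] p m p-prime m>0 =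
  trans (ν-* p p m (prime>0 p-prime) m>0) (cong (_+ ν p m) (ν[p,p]≡1 p p-prime))

∤⇒ν≡0 : ∀ p m → 0 < m → ¬ (p ∣ m) → ν p m ≡ 0
∤⇒ν≡0 p m m>0 p∤m with primeFactors m m>0
... | xs , xs-prime , m≡ with multiplicity p xs in eq
... | zero  = trans (ν≡multiplicity p m xs xs-prime m≡) eq
... | suc _ = ⊥-elim (p∤m (subst (p ∣_) (sym m≡)
                (∈⇒∣product (multiplicity>0⇒∈ p xs (subst (0 <_) (sym eq) (s≤s z≤n))))))

∣⇒ν>0 : ∀ p N → Prime p → 0 < N → p ∣ N → 0 < ν p N
∣⇒ν>0 p N p-prime N>0 p∣N with primeFactors N N>0
... | xs , xs-prime , N≡ = subst (0 <_) (sym (ν≡multiplicity p N xs xs-prime N≡))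
  (∈⇒multiplicity>0 (factorisationHasAllPrimeFactors p-prime (subst (p ∣_) N≡ p∣N) xs-prime))

module Legendre (p : ℕ) (p-prime : Prime p) where

  instance
    p≢0 : NonZero p
    p≢0 = prime⇒nonZero p-prime

  1<p : 1 < p
  1<p = nonTrivial⇒n>1 p {{prime⇒nonTrivial p-prime}}

  νFact : ℕ → ℕ
  νFact n = ν p (n !)

  νFact-suc : ∀ n → νFact (suc n) ≡ ν p (suc n) + νFact n
  νFact-suc n = ν-* p (suc n) (n !) (s≤s z≤n) (1≤n! n)

  p∤1+pq+r : ∀ q r → suc r < p → ¬ (p ∣ suc (p * q + r))
  p∤1+pq+r q r 1+r<p p∣ = <⇒≱ 1+r<p (∣⇒≤ (∣m+n∣m⇒∣n (subst (p ∣_) (sym (+-suc (p * q) r)) p∣) (m∣m*n q)))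

  νFact[pq+r]≡νFact[pq] : ∀ q r → r < p → νFact (p * q + r) ≡ νFact (p * q + 0)
  νFact[pq+r]≡νFact[pq] q zero    r<p = refl
  νFact[pq+r]≡νFact[pq] q (suc r) r<p = begin
      νFact (p * q + suc r)
    ≡⟨ cong νFact (+-suc (p * q) r) ⟩
      νFact (suc (p * q + r))
    ≡⟨ νFact-suc (p * q + r) ⟩
      ν p (suc (p * q + r)) + νFact (p * q + r)
    ≡⟨ cong₂ _+_ (∤⇒ν≡0 p _ (s≤s z≤n) (p∤1+pq+r q r r<p))
                 (νFact[pq+r]≡νFact[pq] q r (<-trans (n<1+n r) r<p)) ⟩
      νFact (p * q + 0)
    ∎
    where open ≡-Reasoning

  legendre : ∀ q r → r < p → νFact (p * q + r) ≡ q + νFact q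
  legendre q r r<p = trans (νFact[pq+r]≡νFact[pq] q r r<p) (legendre₀ q)
    where
    p-1 = p ∸ 1
    p≡1+p-1 : p ≡ suc p-1
    p≡1+p-1 = sym (m+[n∸m]≡n (<⇒≤ 1<p))
    legendre₀ : ∀ q → νFact (p * q + 0) ≡ q + νFact q
    legendre₀ zero    = cong νFact (trans (+-identityʳ (p * 0)) (*-zeroʳ p))
    legendre₀ (suc q) = begin
        νFact (p * suc q + 0)
      ≡⟨ cong νFact (trans (+-identityʳ _) p*[1+q]≡1+pq+p-1) ⟩
        νFact (suc (p * q + p-1))
      ≡⟨ νFact-suc (p * q + p-1) ⟩
        ν p (suc (p * q + p-1)) + νFact (p * q + p-1)
      ≡⟨ cong₂ _+_ (trans (cong (ν p) (sym p*[1+q]≡1+pq+p-1)) (ν[p,p*m]≡1+ν[p,m] p (suc q) p-prime (s≤s z≤n)))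
                   (νFact[pq+r]≡νFact[pq] q p-1 (subst (p-1 <_) (sym p≡1+p-1) (n<1+n p-1))) ⟩
        suc (ν p (suc q)) + νFact (p * q + 0)
      ≡⟨ cong (λ t → suc (ν p (suc q)) + t) (legendre₀ q) ⟩
        suc (ν p (suc q)) + (q + νFact q)
      ≡⟨ cong suc (+-swap (ν p (suc q)) q (νFact q)) ⟩
        suc q + (ν p (suc q) + νFact q)
      ≡⟨ cong (suc q +_) (νFact-suc q) ⟨
        suc q + νFact (suc q)
      ∎
      where
      open ≡-Reasoning
      +-swap : ∀ a b c → a + (b + c) ≡ b + (a + c)
      +-swap = solve-∀
      p*[1+q]≡1+pq+p-1 : p * suc q ≡ suc (p * q + p-1)
      p*[1+q]≡1+pq+p-1 = trans (*-suc p q) (trans (cong (_+ p * q) p≡1+p-1) (cong suc (+-comm p-1 (p * q))))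

  digits : ∀ x → Σ ℕ λ q → Σ ℕ λ r → r < p × x ≡ p * q + r
  digits x = x / p , x % p , m%n<n x p ,
    trans (m≡m%n+[m/n]*n x p) (trans (+-comm (x % p) _) (cong (_+ x % p) (*-comm (x / p) p)))

  νFact-small : ∀ n → n < p → νFact n ≡ 0
  νFact-small n n<p = trans (cong νFact (cong (_+ n) (sym (*-zeroʳ p)))) (legendre 0 n n<p)

  -- Adding the lowest base-p digits of the summands (and an incoming carry c) produces no carry or exactly one.
  carry-digit : ∀ q₁ r₁ q₂ r₂ c e → r₁ < p → r₂ < p → c ≤ 1 →
    let N = (p * q₁ + r₁) + (p * q₂ + r₂) + c in
    νFact (p * q₁ + r₁) + νFact (p * q₂ + r₂) + e ≡ νFact N →
      (νFact q₁ + νFact q₂ + e ≡ νFact (q₁ + q₂ + 0) × p * (q₁ + q₂) ≤ N)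
    ⊎ (νFact q₁ + νFact q₂ + e ≡ suc (νFact (q₁ + q₂ + 1)) × p * (q₁ + q₂ + 1) ≤ N)
  carry-digit q₁ r₁ q₂ r₂ c e r₁<p r₂<p c≤1 eq = split (s <? p)
    where
    Q = q₁ + q₂
    s = r₁ + r₂ + c
    N = (p * q₁ + r₁) + (p * q₂ + r₂) + c
    N≡pQ+s : N ≡ p * Q + s
    N≡pQ+s = regroup p q₁ r₁ q₂ r₂ c
      where
      regroup : ∀ p q₁ r₁ q₂ r₂ c → (p * q₁ + r₁) + (p * q₂ + r₂) + c ≡ p * (q₁ + q₂) + (r₁ + r₂ + c)
      regroup = solve-∀
    eq′ : (q₁ + νFact q₁) + (q₂ + νFact q₂) + e ≡ νFact (p * Q + s)
    eq′ = trans (cong₂ (λ u v → u + v + e) (sym (legendre q₁ r₁ r₁<p)) (sym (legendre q₂ r₂ r₂<p)))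
                (trans eq (cong νFact N≡pQ+s))
    cancel : ∀ C → (q₁ + νFact q₁) + (q₂ + νFact q₂) + e ≡ Q + C → νFact q₁ + νFact q₂ + e ≡ C
    cancel C h = +-cancelˡ-≡ Q _ _ (trans (sym (interchange q₁ q₂ (νFact q₁) (νFact q₂) e)) h)
      where
      interchange : ∀ a b A B e → (a + A) + (b + B) + e ≡ (a + b) + (A + B + e)
      interchange = solve-∀
    split : Dec (s < p) →
        (νFact q₁ + νFact q₂ + e ≡ νFact (Q + 0) × p * Q ≤ N)
      ⊎ (νFact q₁ + νFact q₂ + e ≡ suc (νFact (Q + 1)) × p * (Q + 1) ≤ N)
    split (yes s<p) = inj₁ (trans (cancel (νFact Q) (trans eq′ (legendre Q s s<p))) (cong νFact (sym (+-identityʳ Q))) ,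
                            ≤-trans (m≤m+n (p * Q) s) (≤-reflexive (sym N≡pQ+s)))
    split (no s≮p) = inj₂ (cancel _ (trans eq′ (trans (cong νFact pQ+s≡p[Q+1]+r)
                                      (trans (legendre (Q + 1) r r<p) (+-assoc Q 1 _)))) ,
                           ≤-trans (m≤m+n (p * (Q + 1)) r) (≤-reflexive (sym (trans N≡pQ+s pQ+s≡p[Q+1]+r))))
      where
      r = s ∸ p
      p+r≡s : p + r ≡ s
      p+r≡s = m+[n∸m]≡n (≮⇒≥ s≮p)
      s<p+p : s < p + p
      s<p+p = begin-strict
        r₁ + r₂ + c    ≤⟨ +-monoʳ-≤ (r₁ + r₂) c≤1 ⟩
        r₁ + r₂ + 1    ≡⟨ trans (+-assoc r₁ r₂ 1) (cong (r₁ +_) (+-comm r₂ 1)) ⟩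
        r₁ + suc r₂    ≤⟨ +-monoʳ-≤ r₁ r₂<p ⟩
        r₁ + p         <⟨ +-monoˡ-< p r₁<p ⟩
        p + p          ∎
        where open ≤-Reasoning
      r<p : r < p
      r<p = +-cancelˡ-< p r p (subst (_< p + p) (sym p+r≡s) s<p+p)
      pQ+s≡p[Q+1]+r : p * Q + s ≡ p * (Q + 1) + r
      pQ+s≡p[Q+1]+r = trans (cong (p * Q +_) (sym p+r≡s)) (carry p Q r)
        where
        carry : ∀ p Q r → p * Q + (p + r) ≡ p * (Q + 1) + r
        carry = solve-∀

  pq≤N⇒q<N : ∀ q N → 0 < q → p * q ≤ N → q < N
  pq≤N⇒q<N q N q>0 pq≤N = <-≤-trans (subst (q <_) (*-comm q p) (m<m*n q p {{>-nonZero q>0}} 1<p)) pq≤N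

  -- Kummer's theorem in the form needed here: the carries e satisfy p ^ e ≤ x + y + c.
  CarryBound : ℕ → Set
  CarryBound fuel = ∀ x y c e → x + y + c < fuel → c ≤ 1 →
    νFact x + νFact y + e ≡ νFact (x + y + c) → e ≡ 0 ⊎ p ^ e ≤ x + y + c

  no-carry : ∀ {fuel} → CarryBound fuel → ∀ q₁ q₂ e N → N < suc fuel →
    νFact q₁ + νFact q₂ + e ≡ νFact (q₁ + q₂ + 0) → p * (q₁ + q₂) ≤ N → e ≡ 0 ⊎ p ^ e ≤ N
  no-carry ih q₁ q₂ e N N<fuel eq pQ≤N with q₁ + q₂ ≟ 0
  no-carry ih q₁ q₂ e N N<fuel eq pQ≤N | yes Q≡0 with m+n≡0⇒m≡0 q₁ Q≡0 | m+n≡0⇒n≡0 q₁ Q≡0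
  ... | refl | refl = inj₁ eq
  no-carry {fuel} ih q₁ q₂ e N N<fuel eq pQ≤N | no Q≢0
    with ih q₁ q₂ 0 e (subst (_< fuel) (sym (+-identityʳ _)) (≤-trans (pq≤N⇒q<N _ N Q>0 pQ≤N) (s≤s⁻¹ N<fuel))) z≤n eq
    where
    Q>0 : 0 < q₁ + q₂
    Q>0 = n≢0⇒n>0 Q≢0
  ... | inj₁ e≡0  = inj₁ e≡0
  ... | inj₂ pᵉ≤Q = inj₂ (≤-trans pᵉ≤Q (≤-trans (≤-reflexive (+-identityʳ _)) (≤-trans (m≤n*m _ p) pQ≤N)))

  one-carry : ∀ {fuel} → CarryBound fuel → ∀ q₁ q₂ e N → N < suc fuel →
    νFact q₁ + νFact q₂ + e ≡ suc (νFact (q₁ + q₂ + 1)) → p * (q₁ + q₂ + 1) ≤ N → e ≡ 0 ⊎ p ^ e ≤ N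
  one-carry ih q₁ q₂ zero    N N<fuel eq p[Q+1]≤N = inj₁ refl
  one-carry ih q₁ q₂ (suc e) N N<fuel eq p[Q+1]≤N
    with ih q₁ q₂ 1 e (≤-trans (pq≤N⇒q<N _ N Q+1>0 p[Q+1]≤N) (s≤s⁻¹ N<fuel)) ≤-refl
            (suc-injective (trans (sym (+-suc (νFact q₁ + νFact q₂) e)) eq))
    where
    Q+1>0 : 0 < q₁ + q₂ + 1
    Q+1>0 = subst (0 <_) (+-comm 1 (q₁ + q₂)) (s≤s z≤n)
  ... | inj₁ refl     = inj₂ (≤-trans (*-monoʳ-≤ p (subst (0 <_) (+-comm 1 (q₁ + q₂)) (s≤s z≤n))) p[Q+1]≤N)
  ... | inj₂ pᵉ≤Q+1 = inj₂ (≤-trans (*-monoʳ-≤ p pᵉ≤Q+1) p[Q+1]≤N)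

  carry-bound : ∀ fuel → CarryBound fuel
  carry-bound (suc fuel) x y c e N<fuel c≤1 eq with digits x | digits y
  ... | q₁ , r₁ , r₁<p , refl | q₂ , r₂ , r₂<p , refl with carry-digit q₁ r₁ q₂ r₂ c e r₁<p r₂<p c≤1 eq
  ... | inj₁ (eq′ , le) = no-carry  (carry-bound fuel) q₁ q₂ e _ N<fuel eq′ le
  ... | inj₂ (eq′ , le) = one-carry (carry-bound fuel) q₁ q₂ e _ N<fuel eq′ le

  νFact+νFact+νbinom : ∀ a b → νFact a + νFact b + ν p (binom a b) ≡ νFact (a + b + 0)
  νFact+νFact+νbinom a b = begin
      νFact a + νFact b + ν p (binom a b)
    ≡⟨ rotate (νFact a) (νFact b) _ ⟩
      ν p (binom a b) + νFact a + νFact b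
    ≡⟨ cong (_+ νFact b) (ν-* p (binom a b) (a !) (binom>0 a b) (1≤n! a)) ⟨
      ν p (binom a b * a !) + νFact b
    ≡⟨ ν-* p (binom a b * a !) (b !) (*-mono-≤ (binom>0 a b) (1≤n! a)) (1≤n! b) ⟨
      ν p (binom a b * a ! * b !)
    ≡⟨ cong (ν p) (binom*a!*b!≡[a+b]! a b) ⟩
      νFact (a + b)
    ≡⟨ cong νFact (+-identityʳ (a + b)) ⟨
      νFact (a + b + 0)
    ∎
    where
    open ≡-Reasoning
    rotate : ∀ x y z → x + y + z ≡ z + x + y
    rotate = solve-∀

  p^ν[binom]≤a+b : ∀ a b → 0 < a + b → p ^ ν p (binom a b) ≤ a + b
  p^ν[binom]≤a+b a b a+b>0
    with carry-bound (suc (a + b + 0)) a b 0 (ν p (binom a b)) ≤-refl z≤n (νFact+νFact+νbinom a b)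
  ... | inj₁ ν≡0 rewrite ν≡0 = a+b>0
  ... | inj₂ pᵛ≤ = ≤-trans pᵛ≤ (≤-reflexive (+-identityʳ (a + b)))

  ∣binom⇒≤a+b : ∀ a b → p ∣ binom a b → p ≤ a + b
  ∣binom⇒≤a+b a b p∣ with p ≤? a + b
  ... | yes p≤ = p≤
  ... | no p≰ = ⊥-elim (<⇒≱ (∣⇒ν>0 p (binom a b) p-prime (binom>0 a b) p∣) (≤-reflexive ν≡0))
    where
    a+b<p : a + b < p
    a+b<p = ≰⇒> p≰
    ν≡0 : ν p (binom a b) ≡ 0
    ν≡0 = begin
      ν p (binom a b)                        ≡⟨ cong₂ (λ u v → u + v + ν p (binom a b))
                                                 (νFact-small a (≤-<-trans (m≤m+n a b) a+b<p))
                                                 (νFact-small b (≤-<-trans (m≤n+m b a) a+b<p)) ⟨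
      νFact a + νFact b + ν p (binom a b)    ≡⟨ νFact+νFact+νbinom a b ⟩
      νFact (a + b + 0)                      ≡⟨ cong νFact (+-identityʳ (a + b)) ⟩
      νFact (a + b)                          ≡⟨ νFact-small (a + b) a+b<p ⟩
      0                                      ∎
      where open ≡-Reasoning

  ν[binom[k,k]]>0 : ∀ k → k < p → p ≤ k + k → 0 < ν p (binom k k)
  ν[binom[k,k]]>0 k k<p p≤2k = subst (0 <_) (sym ν≡1) ≤-refl
    where
    r = (k + k) ∸ p
    r<p : r < p
    r<p = +-cancelˡ-< p r p (subst (_< p + p) (sym (m+[n∸m]≡n p≤2k)) (+-mono-< k<p k<p))
    2k≡p+r : k + k + 0 ≡ p * 1 + r
    2k≡p+r = trans (+-identityʳ _) (trans (sym (m+[n∸m]≡n p≤2k)) (cong (_+ r) (sym (*-identityʳ p))))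
    ν≡1 : ν p (binom k k) ≡ 1
    ν≡1 = begin
      ν p (binom k k)                        ≡⟨ cong₂ (λ u v → u + v + ν p (binom k k)) (νFact-small k k<p) (νFact-small k k<p) ⟨
      νFact k + νFact k + ν p (binom k k)    ≡⟨ νFact+νFact+νbinom k k ⟩
      νFact (k + k + 0)                      ≡⟨ cong νFact 2k≡p+r ⟩
      νFact (p * 1 + r)                      ≡⟨ legendre 1 r r<p ⟩
      1                                      ∎
      where open ≡-Reasoning

removeAll : ℕ → List ℕ → List ℕ
removeAll q []       = []
removeAll q (x ∷ xs) = if x ≡ᵇ q then removeAll q xs else x ∷ removeAll q xs

product≡q^multiplicity*product-removeAll : ∀ q xs →
  product xs ≡ q ^ multiplicity q xs * product (removeAll q xs)
product≡q^multiplicity*product-removeAll q [] = refl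
product≡q^multiplicity*product-removeAll q (x ∷ xs) with x ≡ᵇ q in eq
... | true rewrite ≡ᵇ⇒≡ x q (subst T (sym eq) _) =
  trans (cong (q *_) (product≡q^multiplicity*product-removeAll q xs)) (sym (*-assoc q _ _))
... | false =
  trans (cong (x *_) (product≡q^multiplicity*product-removeAll q xs)) (x*[y*z]≡y*[x*z] x (q ^ multiplicity q xs) (product (removeAll q xs)))
  where
  x*[y*z]≡y*[x*z] : ∀ x y z → x * (y * z) ≡ y * (x * z)
  x*[y*z]≡y*[x*z] = solve-∀

multiplicity-removeAll : ∀ q q′ xs → multiplicity q′ (removeAll q xs) ≤ multiplicity q′ xs
multiplicity-removeAll q q′ [] = z≤n
multiplicity-removeAll q q′ (x ∷ xs) with x ≡ᵇ q
... | true  = ≤-trans (multiplicity-removeAll q q′ xs) (m≤n+m _ _)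
... | false = +-monoʳ-≤ (δ x q′) (multiplicity-removeAll q q′ xs)

∈-removeAll⁻ : ∀ q xs {x} → x ∈ removeAll q xs → x ∈ xs × x ≢ q
∈-removeAll⁻ q (y ∷ xs) {x} x∈ with y ≡ᵇ q in eq
... | true = let x∈xs , x≢q = ∈-removeAll⁻ q xs x∈ in there x∈xs , x≢q
∈-removeAll⁻ q (y ∷ xs) {x} (here refl) | false = here refl , λ y≡q → subst T eq (≡⇒≡ᵇ y q y≡q)
∈-removeAll⁻ q (y ∷ xs) {x} (there x∈)  | false = let x∈xs , x≢q = ∈-removeAll⁻ q xs x∈ in there x∈xs , x≢q

product≤B^length : ∀ (P xs : List ℕ) B → 0 < B → (∀ {q} → q ∈ P → 0 < q) → (∀ {x} → x ∈ xs → x ∈ P) →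
  (∀ {q} → q ∈ P → q ^ multiplicity q xs ≤ B) → product xs ≤ B ^ length P
product≤B^length []      []       B B>0 P>0 xs⊆P bound = ≤-refl
product≤B^length []      (x ∷ xs) B B>0 P>0 xs⊆P bound with xs⊆P (here refl)
... | ()
product≤B^length (q ∷ P) xs       B B>0 P>0 xs⊆P bound = begin
    product xs
  ≡⟨ product≡q^multiplicity*product-removeAll q xs ⟩
    q ^ multiplicity q xs * product (removeAll q xs)
  ≤⟨ *-mono-≤ (bound (here refl)) (product≤B^length P (removeAll q xs) B B>0 (λ q∈ → P>0 (there q∈)) rest⊆P rest-bound) ⟩
    B * B ^ length P
  ∎
  where
  open ≤-Reasoning
  rest⊆P : ∀ {x} → x ∈ removeAll q xs → x ∈ P
  rest⊆P x∈ with ∈-removeAll⁻ q xs x∈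
  ... | x∈xs , x≢q with xs⊆P x∈xs
  ... | here x≡q = ⊥-elim (x≢q x≡q)
  ... | there x∈P = x∈P
  rest-bound : ∀ {q′} → q′ ∈ P → q′ ^ multiplicity q′ (removeAll q xs) ≤ B
  rest-bound {q′} q′∈ = ≤-trans (^-monoʳ-≤ q′ {{>-nonZero (P>0 (there q′∈))}} (multiplicity-removeAll q q′ xs))
                                (bound (there q′∈))

product>0 : ∀ xs → (∀ {x} → x ∈ xs → 0 < x) → 0 < product xs
product>0 []       xs>0 = ≤-refl
product>0 (x ∷ xs) xs>0 = *-mono-≤ (xs>0 (here refl)) (product>0 xs (λ x∈ → xs>0 (there x∈)))

m^length≤product : ∀ (Q xs : List ℕ) m → Unique Q → (∀ {q} → q ∈ Q → q ∈ xs) → (∀ {q} → q ∈ Q → m ≤ q) →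
  (∀ {x} → x ∈ xs → 0 < x) → m ^ length Q ≤ product xs
m^length≤product []      xs m Q! Q⊆xs m≤Q xs>0 = product>0 xs xs>0
m^length≤product (q ∷ Q) xs m (q∉Q ∷ Q!) Q⊆xs m≤Q xs>0 with ∈-∃++ (Q⊆xs (here refl))
... | ys , zs , refl = begin
    m * m ^ length Q
  ≤⟨ *-mono-≤ (m≤Q (here refl)) (m^length≤product Q (ys ++ zs) m Q! Q⊆ys++zs (λ q∈ → m≤Q (there q∈)) ys++zs>0) ⟩
    q * product (ys ++ zs)
  ≡⟨ cong (q *_) (product-++ ys zs) ⟩
    q * (product ys * product zs)
  ≡⟨ x*[y*z]≡y*[x*z] q (product ys) (product zs) ⟩
    product ys * (q * product zs)
  ≡⟨ product-++ ys (q ∷ zs) ⟨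
    product (ys ++ q ∷ zs)
  ∎
  where
  open ≤-Reasoning
  x*[y*z]≡y*[x*z] : ∀ x y z → x * (y * z) ≡ y * (x * z)
  x*[y*z]≡y*[x*z] = solve-∀
  Q⊆ys++zs : ∀ {x} → x ∈ Q → x ∈ ys ++ zs
  Q⊆ys++zs {x} x∈ with ∈-++⁻ ys (Q⊆xs (there x∈))
  ... | inj₁ x∈ys         = ∈-++⁺ˡ x∈ys
  ... | inj₂ (here x≡q)   = ⊥-elim (All.lookup q∉Q x∈ (sym x≡q))
  ... | inj₂ (there x∈zs) = ∈-++⁺ʳ ys x∈zs
  ys++zs>0 : ∀ {x} → x ∈ ys ++ zs → 0 < x
  ys++zs>0 x∈ with ∈-++⁻ ys x∈
  ... | inj₁ x∈ys = xs>0 (∈-++⁺ˡ x∈ys)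
  ... | inj₂ x∈zs = xs>0 (∈-++⁺ʳ ys (there x∈zs))

primesIn : ℕ → ℕ → List ℕ
primesIn x zero    = []
primesIn x (suc y) with prime? (suc y) | x <? suc y
... | yes _ | yes _ = suc y ∷ primesIn x y
... | _     | _     = primesIn x y

π : ℕ → ℕ → ℕ
π x y = length (primesIn x y)

∈-primesIn⁻ : ∀ x y {p} → p ∈ primesIn x y → Prime p × x < p × p ≤ y
∈-primesIn⁻ x (suc y) {p} p∈ with prime? (suc y) | x <? suc y
... | yes p-prime | yes x<p with p∈
...   | here refl = p-prime , x<p , ≤-refl
...   | there p∈′ = let p-prime , x<p , p≤y = ∈-primesIn⁻ x y p∈′ in p-prime , x<p , m≤n⇒m≤1+n p≤y
∈-primesIn⁻ x (suc y) {p} p∈ | yes _ | no _ =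
  let p-prime , x<p , p≤y = ∈-primesIn⁻ x y p∈ in p-prime , x<p , m≤n⇒m≤1+n p≤y
∈-primesIn⁻ x (suc y) {p} p∈ | no _  | _    =
  let p-prime , x<p , p≤y = ∈-primesIn⁻ x y p∈ in p-prime , x<p , m≤n⇒m≤1+n p≤y

∈-primesIn⁺ : ∀ x y {p} → Prime p → x < p → p ≤ y → p ∈ primesIn x y
∈-primesIn⁺ x zero    {p} p-prime x<p p≤0 = ⊥-elim (<⇒≱ (≤-<-trans z≤n x<p) p≤0)
∈-primesIn⁺ x (suc y) {p} p-prime x<p p≤y with prime? (suc y) | x <? suc y | p ≟ suc y
... | yes _ | yes _   | yes refl = here refl
... | yes _ | yes _   | no p≢    = there (∈-primesIn⁺ x y p-prime x<p (s≤s⁻¹ (≤∧≢⇒< p≤y p≢)))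
... | yes _ | no x≮   | yes refl = ⊥-elim (x≮ x<p)
... | yes _ | no _    | no p≢    = ∈-primesIn⁺ x y p-prime x<p (s≤s⁻¹ (≤∧≢⇒< p≤y p≢))
... | no ¬p | _       | yes refl = ⊥-elim (¬p p-prime)
... | no _  | _       | no p≢    = ∈-primesIn⁺ x y p-prime x<p (s≤s⁻¹ (≤∧≢⇒< p≤y p≢))

primesIn-unique : ∀ x y → Unique (primesIn x y)
primesIn-unique x zero    = []
primesIn-unique x (suc y) with prime? (suc y) | x <? suc y
... | yes _ | yes _ =
  All.tabulate (λ p∈ p≡ → <⇒≱ (s≤s (proj₂ (proj₂ (∈-primesIn⁻ x y p∈)))) (≤-reflexive p≡)) ∷ primesIn-unique x y
... | yes _ | no _  = primesIn-unique x y
... | no _  | _     = primesIn-unique x y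

π≤ : ∀ x y → π x y ≤ y
π≤ x zero    = z≤n
π≤ x (suc y) with prime? (suc y) | x <? suc y
... | yes _ | yes _ = s≤s (π≤ x y)
... | yes _ | no _  = m≤n⇒m≤1+n (π≤ x y)
... | no _  | _     = m≤n⇒m≤1+n (π≤ x y)

π-empty : ∀ x y → y ≤ x → π x y ≡ 0
π-empty x zero    y≤x = refl
π-empty x (suc y) y≤x with prime? (suc y) | x <? suc y
... | yes _ | yes x<y = ⊥-elim (<⇒≱ x<y y≤x)
... | yes _ | no _    = π-empty x y (≤-trans (n≤1+n y) y≤x)
... | no _  | _       = π-empty x y (≤-trans (n≤1+n y) y≤x)

π-split : ∀ x y z → x ≤ y → y ≤ z → π x z ≡ π y z + π x y
π-split x y zero    x≤y y≤z with n≤0⇒n≡0 y≤z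
... | refl = refl
π-split x y (suc z) x≤y y≤z with y ≟ suc z
... | yes refl = cong (_+ π x (suc z)) (sym (π-empty (suc z) (suc z) ≤-refl))
... | no y≢ with prime? (suc z) | x <? suc z | y <? suc z
...   | yes _ | yes _  | yes _  = cong suc (π-split x y z x≤y (s≤s⁻¹ (≤∧≢⇒< y≤z y≢)))
...   | yes _ | yes _  | no y≮  = ⊥-elim (y≮ (≤∧≢⇒< y≤z y≢))
...   | yes _ | no x≮  | yes y< = ⊥-elim (x≮ (≤-<-trans x≤y y<))
...   | yes _ | no _   | no y≮  = ⊥-elim (y≮ (≤∧≢⇒< y≤z y≢))
...   | no _  | _      | _      = π-split x y z x≤y (s≤s⁻¹ (≤∧≢⇒< y≤z y≢))

binom[m,m]≤[2m]^π : ∀ m → 0 < m → binom m m ≤ (m + m) ^ π 0 (m + m)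
binom[m,m]≤[2m]^π m m>0 with primeFactors (binom m m) (binom>0 m m)
... | xs , xs-prime , binom≡ = subst (_≤ (m + m) ^ π 0 (m + m)) (sym binom≡)
  (product≤B^length (primesIn 0 (m + m)) xs (m + m) (≤-trans m>0 (m≤m+n m m))
    (λ q∈ → prime>0 (proj₁ (∈-primesIn⁻ 0 (m + m) q∈))) xs⊆primes bound)
  where
  xs⊆primes : ∀ {x} → x ∈ xs → x ∈ primesIn 0 (m + m)
  xs⊆primes {x} x∈ = ∈-primesIn⁺ 0 (m + m) x-prime (prime>0 x-prime)
    (Legendre.∣binom⇒≤a+b x x-prime m m (subst (x ∣_) (sym binom≡) (∈⇒∣product x∈)))
    where x-prime = All.lookup xs-prime x∈
  bound : ∀ {q} → q ∈ primesIn 0 (m + m) → q ^ multiplicity q xs ≤ m + m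
  bound {q} q∈ = subst (λ t → q ^ t ≤ m + m) (ν≡multiplicity q (binom m m) xs xs-prime binom≡)
    (Legendre.p^ν[binom]≤a+b q (proj₁ (∈-primesIn⁻ 0 (m + m) q∈)) m m (≤-trans m>0 (m≤m+n m m)))

[1+k]^π≤binom[k,k] : ∀ k → suc k ^ π k (k + k) ≤ binom k k
[1+k]^π≤binom[k,k] k with primeFactors (binom k k) (binom>0 k k)
... | xs , xs-prime , binom≡ = subst (suc k ^ π k (k + k) ≤_) (sym binom≡)
  (m^length≤product (primesIn k (k + k)) xs (suc k) (primesIn-unique k (k + k)) primes⊆xs
    (λ q∈ → proj₁ (proj₂ (∈-primesIn⁻ k (k + k) q∈))) (λ x∈ → prime>0 (All.lookup xs-prime x∈)))
  where
  primes⊆xs : ∀ {q} → q ∈ primesIn k (k + k) → q ∈ xs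
  primes⊆xs {q} q∈ with ∈-primesIn⁻ k (k + k) q∈
  ... | q-prime , k<q , q≤2k = multiplicity>0⇒∈ q xs
    (subst (0 <_) (ν≡multiplicity q (binom k k) xs xs-prime binom≡) (Legendre.ν[binom[k,k]]>0 q q-prime k k<q q≤2k))

2^m≤2^n⇒m≤n : ∀ m n → 2 ^ m ≤ 2 ^ n → m ≤ n
2^m≤2^n⇒m≤n m n 2^m≤2^n with m ≤? n
... | yes m≤n = m≤n
... | no m≰n  = ⊥-elim (<⇒≱ (^-monoʳ-< 2 (s≤s (s≤s z≤n)) (≰⇒> m≰n)) 2^m≤2^n)

2^n+2^n≡2^[1+n] : ∀ n → 2 ^ n + 2 ^ n ≡ 2 ^ suc n
2^n+2^n≡2^[1+n] n = cong (2 ^ n +_) (sym (+-identityʳ (2 ^ n)))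

-- Every prime in (2^i, 2^(i+1)] divides binom(2^i, 2^i) ≤ 2^(2^(i+1)) and exceeds 2^i.
i*π[2^i,2^[1+i]]≤2^[1+i] : ∀ i → i * π (2 ^ i) (2 ^ suc i) ≤ 2 ^ suc i
i*π[2^i,2^[1+i]]≤2^[1+i] i = 2^m≤2^n⇒m≤n _ _ (begin
    2 ^ (i * c)
  ≡⟨ ^-*-assoc 2 i c ⟨
    (2 ^ i) ^ c
  ≤⟨ ^-monoˡ-≤ c (n≤1+n (2 ^ i)) ⟩
    suc (2 ^ i) ^ c
  ≡⟨ cong (λ t → suc (2 ^ i) ^ π (2 ^ i) t) (2^n+2^n≡2^[1+n] i) ⟨
    suc (2 ^ i) ^ π (2 ^ i) (2 ^ i + 2 ^ i)
  ≤⟨ [1+k]^π≤binom[k,k] (2 ^ i) ⟩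
    binom (2 ^ i) (2 ^ i)
  ≤⟨ binom≤2^[a+b] (2 ^ i) (2 ^ i) ⟩
    2 ^ (2 ^ i + 2 ^ i)
  ≡⟨ cong (2 ^_) (2^n+2^n≡2^[1+n] i) ⟩
    2 ^ (2 ^ suc i)
  ∎)
  where
  open ≤-Reasoning
  c = π (2 ^ i) (2 ^ suc i)

a*π[2^a,2^[a+b]]+2^[1+a]≤2^[1+a+b] : ∀ a b → a * π (2 ^ a) (2 ^ (a + b)) + 2 ^ suc a ≤ 2 ^ suc (a + b)
a*π[2^a,2^[a+b]]+2^[1+a]≤2^[1+a+b] a zero
  rewrite +-identityʳ a | π-empty (2 ^ a) (2 ^ a) ≤-refl | *-zeroʳ a = ≤-refl
a*π[2^a,2^[a+b]]+2^[1+a]≤2^[1+a+b] a (suc b) = begin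
    a * π (2 ^ a) (2 ^ (a + suc b)) + 2 ^ suc a
  ≡⟨ cong (λ t → a * π (2 ^ a) (2 ^ t) + 2 ^ suc a) (+-suc a b) ⟩
    a * π (2 ^ a) (2 ^ suc (a + b)) + 2 ^ suc a
  ≡⟨ cong (λ t → a * t + 2 ^ suc a)
       (π-split (2 ^ a) (2 ^ (a + b)) (2 ^ suc (a + b)) (^-monoʳ-≤ 2 (m≤m+n a b)) (^-monoʳ-≤ 2 (n≤1+n (a + b)))) ⟩
    a * (top + rest) + 2 ^ suc a
  ≡⟨ distrib a top rest (2 ^ suc a) ⟩
    a * top + (a * rest + 2 ^ suc a)
  ≤⟨ +-mono-≤ (≤-trans (*-monoˡ-≤ top (m≤m+n a b)) (i*π[2^i,2^[1+i]]≤2^[1+i] (a + b)))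
               (a*π[2^a,2^[a+b]]+2^[1+a]≤2^[1+a+b] a b) ⟩
    2 ^ suc (a + b) + 2 ^ suc (a + b)
  ≡⟨ 2^n+2^n≡2^[1+n] (suc (a + b)) ⟩
    2 ^ suc (suc (a + b))
  ≡⟨ cong (λ t → 2 ^ suc t) (+-suc a b) ⟨
    2 ^ suc (a + suc b)
  ∎
  where
  open ≤-Reasoning
  top = π (2 ^ (a + b)) (2 ^ suc (a + b))
  rest = π (2 ^ a) (2 ^ (a + b))
  distrib : ∀ a x y z → a * (x + y) + z ≡ a * x + (a * y + z)
  distrib = solve-∀

a+a+6≤2^a : ∀ a → 6 ≤ a → a + a + 6 ≤ 2 ^ a
a+a+6≤2^a a 6≤a = go (a ∸ 6) a (m∸n+n≡m 6≤a)
  where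
  go : ∀ k a → k + 6 ≡ a → a + a + 6 ≤ 2 ^ a
  go zero    a refl = ≤ᵇ⇒≤ 18 64 _
  go (suc k) a refl = begin
      suc (k + 6) + suc (k + 6) + 6
    ≡⟨ shift (k + 6) ⟩
      (k + 6 + (k + 6) + 6) + 2
    ≤⟨ +-mono-≤ (go k (k + 6) refl) (^-monoʳ-≤ 2 {1} {k + 6} (≤-trans (s≤s z≤n) (m≤n+m 6 k))) ⟩
      2 ^ (k + 6) + 2 ^ (k + 6)
    ≡⟨ 2^n+2^n≡2^[1+n] (k + 6) ⟩
      2 ^ suc (k + 6)
    ∎
    where
    open ≤-Reasoning
    shift : ∀ x → suc x + suc x + 6 ≡ (x + x + 6) + 2
    shift = solve-∀

-- With j = 2a + r, ℓ = j + 5 and n = 2^j: from 2^M ≤ binom(M,M) ≤ W^π(0,W), where M = 2^(j+4) and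
-- W = 2M = 2^ℓ, one gets 16n ≤ ℓ·π(0,W); the primes up to 2^a and those in (2^a, n] account for
-- at most 7n of this, by the trivial bound and the dyadic bounds.
chebyshev : ∀ a r → 6 ≤ a → r ≤ 1 →
  9 * 2 ^ (a + a + r) ≤ (a + a + r + 5) * π (2 ^ (a + a + r)) (2 ^ (a + a + r + 5))
chebyshev a r 6≤a r≤1 = +-cancelʳ-≤ (7 * n) (9 * n) (ℓ * big) (begin
    9 * n + 7 * n
  ≡⟨ sixteen n ⟩
    n * 16
  ≡⟨ ^-distribˡ-+-* 2 j 4 ⟨
    M
  ≤⟨ M≤ℓ*π[0,W] ⟩
    ℓ * (big + (mid + small))
  ≡⟨ distrib ℓ big mid small ⟩
    ℓ * big + (ℓ * mid + ℓ * small)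
  ≤⟨ +-monoʳ-≤ (ℓ * big) (+-mono-≤ ℓ*mid≤6n ℓ*small≤n) ⟩
    ℓ * big + (6 * n + n)
  ≡⟨ cong (ℓ * big +_) (seven n) ⟩
    ℓ * big + 7 * n
  ∎)
  where
  open ≤-Reasoning
  sixteen : ∀ n → 9 * n + 7 * n ≡ n * 16
  sixteen = solve-∀
  seven : ∀ n → 6 * n + n ≡ 7 * n
  seven = solve-∀
  distrib : ∀ c x y z → c * (x + (y + z)) ≡ c * x + (c * y + c * z)
  distrib = solve-∀
  j = a + a + r
  ℓ = j + 5
  n = 2 ^ j
  t = 2 ^ a
  M = 2 ^ (j + 4)
  W = 2 ^ ℓ
  big = π n W
  mid = π t n
  small = π 0 t
  M+M≡W : M + M ≡ W
  M+M≡W = trans (2^n+2^n≡2^[1+n] (j + 4)) (cong (2 ^_) (sym (+-suc j 4)))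
  t≤n : t ≤ n
  t≤n = ^-monoʳ-≤ 2 (≤-trans (m≤m+n a a) (m≤m+n (a + a) r))
  π[0,W]≡ : π 0 W ≡ big + (mid + small)
  π[0,W]≡ = trans (π-split 0 n W z≤n (^-monoʳ-≤ 2 (m≤m+n j 5))) (cong (big +_) (π-split 0 t n z≤n t≤n))
  M≤ℓ*π[0,W] : M ≤ ℓ * (big + (mid + small))
  M≤ℓ*π[0,W] = 2^m≤2^n⇒m≤n _ _ (begin
      2 ^ M                         ≤⟨ 2^m≤binom[m,m] M ⟩
      binom M M                     ≤⟨ binom[m,m]≤[2m]^π M (m^n>0 2 (j + 4)) ⟩
      (M + M) ^ π 0 (M + M)         ≡⟨ cong (λ w → w ^ π 0 w) M+M≡W ⟩
      W ^ π 0 W                     ≡⟨ cong (W ^_) π[0,W]≡ ⟩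
      W ^ (big + (mid + small))     ≡⟨ ^-*-assoc 2 ℓ (big + (mid + small)) ⟩
      2 ^ (ℓ * (big + (mid + small))) ∎)
  ℓ≤2a+6 : ℓ ≤ a + a + 6
  ℓ≤2a+6 = begin
    a + a + r + 5   ≤⟨ +-monoˡ-≤ 5 (+-monoʳ-≤ (a + a) r≤1) ⟩
    a + a + 1 + 5   ≡⟨ +-assoc (a + a) 1 5 ⟩
    a + a + 6       ∎
  ℓ*small≤n : ℓ * small ≤ n
  ℓ*small≤n = begin
    ℓ * small       ≤⟨ *-monoʳ-≤ ℓ (π≤ 0 t) ⟩
    ℓ * t           ≤⟨ *-monoˡ-≤ t (≤-trans ℓ≤2a+6 (a+a+6≤2^a a 6≤a)) ⟩
    t * t           ≡⟨ ^-distribˡ-+-* 2 a a ⟨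
    2 ^ (a + a)     ≤⟨ ^-monoʳ-≤ 2 (m≤m+n (a + a) r) ⟩
    n               ∎
  ℓ≤3a : ℓ ≤ 3 * a
  ℓ≤3a = ≤-trans ℓ≤2a+6 (subst (a + a + 6 ≤_) (triple a) (+-monoʳ-≤ (a + a) 6≤a))
    where
    triple : ∀ a → a + a + a ≡ 3 * a
    triple = solve-∀
  a*mid≤2n : a * mid ≤ 2 * n
  a*mid≤2n = begin
    a * mid                                   ≤⟨ m≤m+n (a * mid) _ ⟩
    a * mid + 2 ^ suc a                       ≡⟨ cong (λ u → a * π t (2 ^ u) + 2 ^ suc a) (+-assoc a a r) ⟩
    a * π t (2 ^ (a + (a + r))) + 2 ^ suc a   ≤⟨ a*π[2^a,2^[a+b]]+2^[1+a]≤2^[1+a+b] a (a + r) ⟩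
    2 ^ suc (a + (a + r))                     ≡⟨ cong (λ u → 2 ^ suc u) (+-assoc a a r) ⟨
    2 * n                                     ∎
  ℓ*mid≤6n : ℓ * mid ≤ 6 * n
  ℓ*mid≤6n = begin
    ℓ * mid          ≤⟨ *-monoˡ-≤ mid ℓ≤3a ⟩
    3 * a * mid      ≡⟨ *-assoc 3 a mid ⟩
    3 * (a * mid)    ≤⟨ *-monoʳ-≤ 3 a*mid≤2n ⟩
    3 * (2 * n)      ≡⟨ *-assoc 3 2 n ⟨
    6 * n            ∎

squareDivisor? : ∀ n B → (Σ ℕ λ m → 2 ≤ m × m ≤ B × m * m ∣ n) ⊎ (∀ m → 2 ≤ m → m ≤ B → ¬ (m * m ∣ n))
squareDivisor? n zero    = inj₂ (λ m 2≤m m≤0 _ → <⇒≱ (≤-trans (s≤s z≤n) 2≤m) m≤0)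
squareDivisor? n (suc B) with squareDivisor? n B
... | inj₁ (m , 2≤m , m≤B , m²∣n) = inj₁ (m , 2≤m , m≤n⇒m≤1+n m≤B , m²∣n)
... | inj₂ none≤B with 2 ≤? suc B | (suc B * suc B) ∣? n
...   | yes 2≤1+B | yes ∣n = inj₁ (suc B , 2≤1+B , ≤-refl , ∣n)
...   | yes _     | no ∤n  = inj₂ none
  where
  none : ∀ m → 2 ≤ m → m ≤ suc B → ¬ (m * m ∣ n)
  none m 2≤m m≤1+B m²∣n with m ≟ suc B
  ... | yes refl = ∤n m²∣n
  ... | no m≢    = none≤B m 2≤m (s≤s⁻¹ (≤∧≢⇒< m≤1+B m≢)) m²∣n
...   | no 2≰1+B  | _      = inj₂ none
  where
  none : ∀ m → 2 ≤ m → m ≤ suc B → ¬ (m * m ∣ n)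
  none m 2≤m m≤1+B m²∣n with m ≟ suc B
  ... | yes refl = 2≰1+B 2≤m
  ... | no m≢    = none≤B m 2≤m (s≤s⁻¹ (≤∧≢⇒< m≤1+B m≢)) m²∣n

squarefreePart-exists : ∀ n → 0 < n → Σ ℕ λ k → IsSquarefreePart n k
squarefreePart-exists n = go n n ≤-refl
  where
  go : ∀ fuel n → n ≤ fuel → 0 < n → Σ ℕ λ k → IsSquarefreePart n k
  go fuel n n≤fuel n>0 with squareDivisor? n n
  go fuel n n≤fuel n>0 | inj₂ none = n , (n>0 , squarefree) , 1 , sym (*-identityʳ n)
    where
    squarefree : ∀ m → m * m ∣ n → m ≡ 1
    squarefree zero          m²∣n = ⊥-elim (<⇒≢ n>0 (sym (0∣⇒≡0 m²∣n)))
    squarefree (suc zero)    m²∣n = refl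
    squarefree (suc (suc m)) m²∣n = ⊥-elim (none (suc (suc m)) (s≤s (s≤s z≤n))
      (≤-trans (m≤m*n (suc (suc m)) (suc (suc m))) (∣⇒≤ {{>-nonZero n>0}} m²∣n)) m²∣n)
  go zero       n n≤0 n>0 | inj₁ _ = ⊥-elim (<⇒≱ n>0 n≤0)
  go (suc fuel) n n≤fuel n>0 | inj₁ (m , 2≤m , _ , divides q n≡q*m²) with go fuel q q≤fuel q>0
    where
    q>0 : 0 < q
    q>0 = n≢0⇒n>0 λ { refl → <⇒≢ n>0 (sym n≡q*m²) }
    q≤fuel : q ≤ fuel
    q≤fuel = s≤s⁻¹ (begin
      suc q              ≤⟨ +-monoʳ-≤ 1 (≤-trans (m≤n+m q q) (+-monoʳ-≤ q (m≤m+n q q))) ⟩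
      1 + (q + (q + q))  ≤⟨ +-monoˡ-≤ (q + (q + q)) q>0 ⟩
      q + (q + (q + q))  ≡⟨ times4 q ⟩
      q * 4              ≤⟨ *-monoʳ-≤ q (*-mono-≤ 2≤m 2≤m) ⟩
      q * (m * m)        ≡⟨ n≡q*m² ⟨
      n                  ≤⟨ n≤fuel ⟩
      suc fuel           ∎)
      where
      open ≤-Reasoning
      times4 : ∀ q → q + (q + (q + q)) ≡ q * 4
      times4 = solve-∀
  ... | k , k-sqf , s , q≡k*s² = k , k-sqf , m * s , trans n≡q*m² (trans (cong (_* (m * m)) q≡k*s²) (regroup k s m))
    where
    regroup : ∀ k s m → k * (s * s) * (m * m) ≡ k * ((m * s) * (m * s))
    regroup = solve-∀

coprime-*ʳ : ∀ {a b c} → Coprime a b → Coprime a c → Coprime a (b * c)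
coprime-*ʳ {a} {b} {c} a⊥b a⊥c {d} (d∣a , d∣bc) = a⊥c (d∣a , coprime-divisor d⊥b d∣bc)
  where
  d⊥b : Coprime d b
  d⊥b (e∣d , e∣b) = a⊥b (∣-trans e∣d d∣a , e∣b)

coprime-² : ∀ {a b} → Coprime a b → Coprime (a * a) (b * b)
coprime-² a⊥b = Coprime.sym (coprime-*ʳ b²⊥a b²⊥a)
  where
  b²⊥a = Coprime.sym (coprime-*ʳ a⊥b a⊥b)

-- Dividing m and m′ by their gcd g leaves coprime a, b with k a² = k′ b², and squarefreeness forces a = b = 1.
squarefreePart-unique : ∀ {N k k′} → 0 < N → IsSquarefreePart N k → IsSquarefreePart N k′ → k ≡ k′
squarefreePart-unique {N} {k} {k′} N>0 (k-sqf , m , N≡km²) (k′-sqf , m′ , N≡k′m′²) = begin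
    k             ≡⟨ *-identityʳ k ⟨
    k * (1 * 1)   ≡⟨ cong (λ t → k * (t * t)) a≡1 ⟨
    k * (a * a)   ≡⟨ ka²≡k′b² ⟩
    k′ * (b * b)  ≡⟨ cong (λ t → k′ * (t * t)) b≡1 ⟩
    k′ * (1 * 1)  ≡⟨ *-identityʳ k′ ⟩
    k′            ∎
  where
  open ≡-Reasoning
  m≢0 : m ≢ 0
  m≢0 refl = <⇒≢ N>0 (sym (trans N≡km² (*-zeroʳ k)))
  g = gcd m m′
  instance
    g≢0 : NonZero g
    g≢0 = ≢-nonZero (gcd[m,n]≢0 m m′ (inj₁ m≢0))
  a = m / g
  b = m′ / g
  regroup : ∀ k a g → k * ((a * g) * (a * g)) ≡ (k * (a * a)) * (g * g)
  regroup = solve-∀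
  ka²≡k′b² : k * (a * a) ≡ k′ * (b * b)
  ka²≡k′b² = *-cancelʳ-≡ _ _ (g * g) {{m*n≢0 g g}} (begin
    k * (a * a) * (g * g)     ≡⟨ regroup k a g ⟨
    k * ((a * g) * (a * g))   ≡⟨ cong (λ t → k * (t * t)) (m/n*n≡m (gcd[m,n]∣m m m′)) ⟩
    k * (m * m)               ≡⟨ trans (sym N≡km²) N≡k′m′² ⟩
    k′ * (m′ * m′)            ≡⟨ cong (λ t → k′ * (t * t)) (m/n*n≡m (gcd[m,n]∣n m m′)) ⟨
    k′ * ((b * g) * (b * g))  ≡⟨ regroup k′ b g ⟩
    k′ * (b * b) * (g * g)    ∎)
  a⊥b : Coprime a b
  a⊥b = coprime-/gcd m m′
  a≡1 : a ≡ 1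
  a≡1 = proj₂ k′-sqf a (coprime-divisor (coprime-² a⊥b) (divides k (trans (*-comm (b * b) k′) (sym ka²≡k′b²))))
  b≡1 : b ≡ 1
  b≡1 = proj₂ k-sqf b (coprime-divisor (coprime-² (Coprime.sym a⊥b)) (divides k′ (trans (*-comm (a * a) k) ka²≡k′b²)))

-- sqf 0 = 0 is a junk value.
sqf : ℕ → ℕ
sqf zero    = 0
sqf (suc n) = proj₁ (squarefreePart-exists (suc n) (s≤s z≤n))

sqf-isSquarefreePart : ∀ n → 0 < n → IsSquarefreePart n (sqf n)
sqf-isSquarefreePart (suc n) _ = proj₂ (squarefreePart-exists (suc n) (s≤s z≤n))

module _ {A B : Set} (R : A → B → Set) where

  injective-relation⇒length≤ : ∀ (L : List A) (T : List B) → Unique L →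
    (∀ {k} → k ∈ L → Σ B λ t → t ∈ T × R k t) → (∀ {k k′ t} → R k t → R k′ t → k ≡ k′) →
    length L ≤ length T
  injective-relation⇒length≤ []      T L! image injective = z≤n
  injective-relation⇒length≤ (k ∷ L) T (k∉L ∷ L!) image injective with image (here refl)
  ... | t , t∈T , Rkt with ∈-∃++ t∈T
  ... | ys , zs , refl = begin
      suc (length L)                 ≤⟨ s≤s (injective-relation⇒length≤ L (ys ++ zs) L! image′ injective) ⟩
      suc (length (ys ++ zs))        ≡⟨ cong suc (length-++ ys) ⟩
      suc (length ys + length zs)    ≡⟨ +-suc (length ys) (length zs) ⟨
      length ys + length (t ∷ zs)    ≡⟨ length-++ ys ⟨
      length (ys ++ t ∷ zs)          ∎
    where
    open ≤-Reasoning
    image′ : ∀ {k′} → k′ ∈ L → Σ B λ t′ → t′ ∈ ys ++ zs × R k′ t′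
    image′ {k′} k′∈ with image (there k′∈)
    ... | t′ , t′∈ , Rk′t′ with ∈-++⁻ ys t′∈
    ...   | inj₁ t′∈ys          = t′ , ∈-++⁺ˡ t′∈ys , Rk′t′
    ...   | inj₂ (here refl)    = ⊥-elim (All.lookup k∉L k′∈ (injective Rkt Rk′t′))
    ...   | inj₂ (there t′∈zs)  = t′ , ∈-++⁺ʳ ys t′∈zs , Rk′t′

unique-⊆⇒length≤ : ∀ {A : Set} (L M : List A) → Unique L → (∀ {x} → x ∈ L → x ∈ M) → length L ≤ length M
unique-⊆⇒length≤ L M L! L⊆M = injective-relation⇒length≤ _≡_ L M L! (λ x∈ → _ , L⊆M x∈ , refl) (λ p q → trans p (sym q))

module _ {A : Set} {P : A → Set} (P? : (x : A) → Dec (P x)) where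

  length≡length-filter+length-filter¬ : ∀ xs → length xs ≡ length (filter P? xs) + length (filter (¬? ∘ P?) xs)
  length≡length-filter+length-filter¬ [] = refl
  length≡length-filter+length-filter¬ (x ∷ xs) with does (P? x)
  ... | true  = cong suc (length≡length-filter+length-filter¬ xs)
  ... | false = trans (cong suc (length≡length-filter+length-filter¬ xs)) (sym (+-suc _ _))

  length∸length≤length-filter : ∀ xs (Bad : List A) → Unique xs → (∀ {x} → x ∈ xs → ¬ P x → x ∈ Bad) →
    length xs ∸ length Bad ≤ length (filter P? xs)
  length∸length≤length-filter xs Bad xs! bad = begin
      length xs ∸ length Bad
    ≡⟨ cong (_∸ length Bad) (trans (length≡length-filter+length-filter¬ xs) (+-comm (length (filter P? xs)) _)) ⟩
      (length rejected + length (filter P? xs)) ∸ length Bad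
    ≤⟨ ∸-monoʳ-≤ _ (unique-⊆⇒length≤ rejected Bad (Unique.filter⁺ (¬? ∘ P?) xs!) rejected⊆Bad) ⟩
      (length rejected + length (filter P? xs)) ∸ length rejected
    ≡⟨ m+n∸m≡n (length rejected) _ ⟩
      length (filter P? xs)
    ∎
    where
    open ≤-Reasoning
    rejected = filter (¬? ∘ P?) xs
    rejected⊆Bad : ∀ {x} → x ∈ rejected → x ∈ Bad
    rejected⊆Bad x∈ = let x∈xs , ¬Px = ∈-filter⁻ (¬? ∘ P?) {xs = xs} x∈ in bad x∈xs ¬Px

module _ {A : Set} (χ : A → ℕ) where

  length≤bound*length-image : ∀ M (L : List ℕ) (G : List A) → Unique G → (∀ {g} → g ∈ G → χ g ∈ L) →
    (∀ {g₀} → g₀ ∈ G → Σ (List A) λ C → length C ≤ M × (∀ {g} → g ∈ G → χ g ≡ χ g₀ → g ∈ C)) →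
    length G ≤ M * length L
  length≤bound*length-image M []      []      G! image fibre = z≤n
  length≤bound*length-image M []      (g ∷ G) G! image fibre with image (here refl)
  ... | ()
  length≤bound*length-image M (k ∷ L) G       G! image fibre = begin
      length G
    ≡⟨ length≡length-filter+length-filter¬ (λ g → χ g ≟ k) G ⟩
      length fibreₖ + length rest
    ≤⟨ +-mono-≤ |fibreₖ|≤M |rest|≤ ⟩
      M + M * length L
    ≡⟨ *-suc M (length L) ⟨
      M * suc (length L)
    ∎
    where
    open ≤-Reasoning
    fibreₖ = filter (λ g → χ g ≟ k) G
    rest = filter (¬? ∘ (λ g → χ g ≟ k)) G
    |fibreₖ|≤M : length fibreₖ ≤ M
    |fibreₖ|≤M with fibreₖ in fibreₖ≡
    ... | []         = z≤n
    ... | g₀ ∷ others with ∈-filter⁻ (λ g → χ g ≟ k) {xs = G} (subst (g₀ ∈_) (sym fibreₖ≡) (here refl))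
    ...   | g₀∈G , χg₀≡k with fibre g₀∈G
    ...     | C , |C|≤M , fibre⊆C =
      ≤-trans (unique-⊆⇒length≤ (g₀ ∷ others) C (subst Unique fibreₖ≡ (Unique.filter⁺ (λ g → χ g ≟ k) G!)) ⊆C) |C|≤M
      where
      ⊆C : ∀ {x} → x ∈ g₀ ∷ others → x ∈ C
      ⊆C {x} x∈ = let x∈G , χx≡k = ∈-filter⁻ (λ g → χ g ≟ k) {xs = G} (subst (x ∈_) (sym fibreₖ≡) x∈)
                  in fibre⊆C x∈G (trans χx≡k (sym χg₀≡k))
    |rest|≤ : length rest ≤ M * length L
    |rest|≤ = length≤bound*length-image M L rest (Unique.filter⁺ (¬? ∘ (λ g → χ g ≟ k)) G!) image′ fibre′
      where
      image′ : ∀ {g} → g ∈ rest → χ g ∈ L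
      image′ g∈ with ∈-filter⁻ (¬? ∘ (λ g → χ g ≟ k)) {xs = G} g∈
      ... | g∈G , χg≢k with image g∈G
      ...   | here χg≡k = ⊥-elim (χg≢k χg≡k)
      ...   | there χg∈L = χg∈L
      fibre′ : ∀ {g₀} → g₀ ∈ rest → Σ (List A) λ C → length C ≤ M × (∀ {g} → g ∈ rest → χ g ≡ χ g₀ → g ∈ C)
      fibre′ g₀∈ with fibre (proj₁ (∈-filter⁻ (¬? ∘ (λ g → χ g ≟ k)) {xs = G} g₀∈))
      ... | C , |C|≤M , fibre⊆C =
        C , |C|≤M , λ g∈ → fibre⊆C (proj₁ (∈-filter⁻ (¬? ∘ (λ g → χ g ≟ k)) {xs = G} g∈))

length-cartesianProduct : ∀ {A B : Set} (xs : List A) (ys : List B) →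
  length (cartesianProduct xs ys) ≡ length xs * length ys
length-cartesianProduct []       ys = refl
length-cartesianProduct (x ∷ xs) ys =
  trans (length-++ (map (x ,_) ys)) (cong₂ _+_ (length-map (x ,_) ys) (length-cartesianProduct xs ys))

module _ {A B : Set} {Q : A × B → Set} (Q? : (g : A × B) → Dec (Q g)) where

  length-filter-map-, : ∀ x (ys : List B) → length (filter Q? (map (x ,_) ys)) ≡ length (filter (λ y → Q? (x , y)) ys)
  length-filter-map-, x []       = refl
  length-filter-map-, x (y ∷ ys) with does (Q? (x , y))
  ... | true  = cong suc (length-filter-map-, x ys)
  ... | false = length-filter-map-, x ys

  length*c≤length-filter-cartesianProduct : ∀ xs ys c → (∀ {x} → x ∈ xs → c ≤ length (filter (λ y → Q? (x , y)) ys)) →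
    length xs * c ≤ length (filter Q? (cartesianProduct xs ys))
  length*c≤length-filter-cartesianProduct []       ys c row = z≤n
  length*c≤length-filter-cartesianProduct (x ∷ xs) ys c row = begin
      c + length xs * c
    ≤⟨ +-mono-≤ (subst (c ≤_) (sym (length-filter-map-, x ys)) (row (here refl)))
                (length*c≤length-filter-cartesianProduct xs ys c (λ x∈ → row (there x∈))) ⟩
      length (filter Q? (map (x ,_) ys)) + length (filter Q? (cartesianProduct xs ys))
    ≡⟨ length-++ (filter Q? (map (x ,_) ys)) ⟨
      length (filter Q? (map (x ,_) ys) ++ filter Q? (cartesianProduct xs ys))
    ≡⟨ cong length (filter-++ Q? (map (x ,_) ys) (cartesianProduct xs ys)) ⟨
      length (filter Q? (map (x ,_) ys ++ cartesianProduct xs ys))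
    ∎
    where open ≤-Reasoning

heron>0 : ∀ {a b c} → NonDegTriangle a b c → 0 < heron a b c
heron>0 {a} {b} {c} (c<a+b , b<a+c , a<b+c) =
  *-mono-≤ (*-mono-≤ (*-mono-≤ perimeter>0 (m<n⇒0<n∸m c<a+b)) (m<n⇒0<n∸m b<a+c)) (m<n⇒0<n∸m a<b+c)
  where
  perimeter>0 : 0 < a + b + c
  perimeter>0 = ≤-trans (≤-<-trans z≤n c<a+b) (m≤m+n (a + b) c)

onFirst onSecond onThird : ℕ → ℕ × ℕ → ℕ × ℕ × ℕ
onFirst  d (x , y) = d , x , y
onSecond d (x , y) = x , d , y
onThird  d (x , y) = x , y , d

sidesWithOne : ℕ → List (ℕ × ℕ × ℕ)
sidesWithOne d = map (onFirst d) P ++ map (onSecond d) P ++ map (onThird d) P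
  where P = cartesianProduct (upTo (suc d)) (upTo (suc d))

length-sidesWithOne : ∀ d → length (sidesWithOne d) ≡ 3 * (suc d * suc d)
length-sidesWithOne d = begin
    length (map (onFirst d) P ++ map (onSecond d) P ++ map (onThird d) P)
  ≡⟨ trans (length-++ (map (onFirst d) P)) (cong (length (map (onFirst d) P) +_) (length-++ (map (onSecond d) P))) ⟩
    length (map (onFirst d) P) + (length (map (onSecond d) P) + length (map (onThird d) P))
  ≡⟨ cong₂ _+_ (length-map (onFirst d) P) (cong₂ _+_ (length-map (onSecond d) P) (length-map (onThird d) P)) ⟩
    length P + (length P + length P)
  ≡⟨ cong (λ t → t + (t + t)) (trans (length-cartesianProduct (upTo (suc d)) (upTo (suc d)))
                                     (cong₂ _*_ (length-upTo (suc d)) (length-upTo (suc d)))) ⟩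
    suc d * suc d + (suc d * suc d + suc d * suc d)
  ≡⟨ cong (λ t → suc d * suc d + (suc d * suc d + t)) (+-identityʳ _) ⟨
    3 * (suc d * suc d)
  ∎
  where
  open ≡-Reasoning
  P = cartesianProduct (upTo (suc d)) (upTo (suc d))

∈-sidesWithOne : ∀ d a b c → a ⊔ b ⊔ c ≡ d → (a , b , c) ∈ sidesWithOne d
∈-sidesWithOne d a b c max≡d = place (⊔-sel (a ⊔ b) c)
  where
  P = cartesianProduct (upTo (suc d)) (upTo (suc d))
  ≤d : ∀ {x} → x ≤ a ⊔ b ⊔ c → x ∈ upTo (suc d)
  ≤d x≤max = ∈-upTo⁺ (s≤s (subst (_ ≤_) max≡d x≤max))
  a∈ : a ∈ upTo (suc d)
  a∈ = ≤d (≤-trans (m≤m⊔n a b) (m≤m⊔n (a ⊔ b) c))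
  b∈ : b ∈ upTo (suc d)
  b∈ = ≤d (≤-trans (m≤n⊔m a b) (m≤m⊔n (a ⊔ b) c))
  c∈ : c ∈ upTo (suc d)
  c∈ = ≤d (m≤n⊔m (a ⊔ b) c)
  place : (a ⊔ b ⊔ c ≡ a ⊔ b) ⊎ (a ⊔ b ⊔ c ≡ c) → (a , b , c) ∈ sidesWithOne d
  place (inj₂ max≡c) with trans (sym max≡c) max≡d
  ... | refl = ∈-++⁺ʳ (map (onFirst d) P) (∈-++⁺ʳ (map (onSecond d) P) (∈-map⁺ (onThird d) (∈-cartesianProduct⁺ a∈ b∈)))
  place (inj₁ max≡a⊔b) with ⊔-sel a b
  ... | inj₁ a⊔b≡a with trans (sym (trans max≡a⊔b a⊔b≡a)) max≡d
  ...   | refl = ∈-++⁺ˡ (∈-map⁺ (onFirst d) (∈-cartesianProduct⁺ b∈ c∈))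
  place (inj₁ max≡a⊔b) | inj₂ a⊔b≡b with trans (sym (trans max≡a⊔b a⊔b≡b)) max≡d
  ...   | refl = ∈-++⁺ʳ (map (onFirst d) P) (∈-++⁺ˡ (∈-map⁺ (onSecond d) (∈-cartesianProduct⁺ a∈ c∈)))

N≤12d² : ∀ d → 0 < d → ∀ (L : List ℕ) → EnumeratesChars d L → length L ≤ 12 * (d * d)
N≤12d² d d>0 L (L! , L↔) = begin
    length L                      ≤⟨ injective-relation⇒length≤ HasCharacteristic L (sidesWithOne d) L! image injective ⟩
    length (sidesWithOne d)       ≡⟨ length-sidesWithOne d ⟩
    3 * (suc d * suc d)           ≤⟨ *-monoʳ-≤ 3 (*-mono-≤ 1+d≤2d 1+d≤2d) ⟩
    3 * ((d + d) * (d + d))       ≡⟨ twelve d ⟩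
    12 * (d * d)                  ∎
  where
  open ≤-Reasoning
  HasCharacteristic : ℕ → ℕ × ℕ × ℕ → Set
  HasCharacteristic k (a , b , c) = NonDegTriangle a b c × IsCharacteristic a b c k
  twelve : ∀ d → 3 * ((d + d) * (d + d)) ≡ 12 * (d * d)
  twelve = solve-∀
  1+d≤2d : suc d ≤ d + d
  1+d≤2d = +-monoˡ-≤ d d>0
  image : ∀ {k} → k ∈ L → Σ (ℕ × ℕ × ℕ) λ t → t ∈ sidesWithOne d × HasCharacteristic k t
  image {k} k∈L with Equivalence.to (L↔ k) k∈L
  ... | a , b , c , triangle , max≡d , char = (a , b , c) , ∈-sidesWithOne d a b c max≡d , triangle , char
  injective : ∀ {k k′ t} → HasCharacteristic k t → HasCharacteristic k′ t → k ≡ k′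
  injective {t = a , b , c} (triangle , char) (_ , char′) = squarefreePart-unique (heron>0 triangle) char char′

-- For odd lo < hi, the triangle (d, d − (hi − lo)/2, (lo + hi)/2) has this Heron product.
heronPair : ℕ → ℕ → ℕ → ℕ
heronPair d lo hi = (d + d + lo) * ((d + d) ∸ hi) * hi * lo

pairTriangle-shape : ∀ b e i → 0 < e → (i + e) + (i + e) + 1 ≤ b + e →
  let c = i + (i + e) + 1 in
  NonDegTriangle (b + e) b c × ((b + e) ⊔ b ⊔ c ≡ b + e) ×
  heron (b + e) b c ≡ heronPair (b + e) (i + i + 1) ((i + e) + (i + e) + 1)
pairTriangle-shape b e i e>0 hi≤a = (c<a+b , b<a+c , a<b+c) , max≡a , heron≡
  where
  c = i + (i + e) + 1
  a = b + e
  c≤hi : c ≤ (i + e) + (i + e) + 1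
  c≤hi = subst (c ≤_) (sym (hi≡e+c e i)) (m≤n+m c e)
    where
    hi≡e+c : ∀ e i → (i + e) + (i + e) + 1 ≡ e + (i + (i + e) + 1)
    hi≡e+c = solve-∀
  c≤a : c ≤ a
  c≤a = ≤-trans c≤hi hi≤a
  b>0 : 0 < b
  b>0 = +-cancelʳ-≤ e 1 b (≤-trans (subst (1 + e ≤_) (sym (hi≡ i e)) (m≤m+n (1 + e) _)) hi≤a)
    where
    hi≡ : ∀ i e → (i + e) + (i + e) + 1 ≡ (1 + e) + (i + i + e)
    hi≡ = solve-∀
  b+c≡a+lo : b + c ≡ a + (i + i + 1)
  b+c≡a+lo = b+c≡ b e i
    where
    b+c≡ : ∀ b e i → b + (i + (i + e) + 1) ≡ (b + e) + (i + i + 1)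
    b+c≡ = solve-∀
  c<a+b : c < a + b
  c<a+b = ≤-<-trans c≤a (m<m+n a b>0)
  b<a+c : b < a + c
  b<a+c = ≤-<-trans (m≤m+n b e) (m<m+n a (subst (0 <_) (+-comm 1 (i + (i + e))) (s≤s z≤n)))
  a<b+c : a < b + c
  a<b+c = subst (a <_) (sym b+c≡a+lo) (m<m+n a (subst (0 <_) (+-comm 1 (i + i)) (s≤s z≤n)))
  max≡a : a ⊔ b ⊔ c ≡ a
  max≡a = trans (cong (_⊔ c) (m≥n⇒m⊔n≡m (m≤m+n b e))) (m≥n⇒m⊔n≡m c≤a)
  perimeter : a + b + c ≡ a + a + (i + i + 1)
  perimeter = perimeter≡ b e i
    where
    perimeter≡ : ∀ b e i → (b + e) + b + (i + (i + e) + 1) ≡ (b + e) + (b + e) + (i + i + 1)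
    perimeter≡ = solve-∀
  a+b∸c : (a + b) ∸ c ≡ (a + a) ∸ ((i + e) + (i + e) + 1)
  a+b∸c = begin
      (a + b) ∸ c
    ≡⟨ cong₂ _∸_ (regroup b e) (c≡ e i) ⟩
      (e + (b + b)) ∸ (e + (i + i + 1))
    ≡⟨ [m+n]∸[m+o]≡n∸o e (b + b) (i + i + 1) ⟩
      (b + b) ∸ (i + i + 1)
    ≡⟨ [m+n]∸[m+o]≡n∸o (e + e) (b + b) (i + i + 1) ⟨
      ((e + e) + (b + b)) ∸ ((e + e) + (i + i + 1))
    ≡⟨ cong₂ _∸_ (a+a≡ b e) (hi≡ e i) ⟨
      (a + a) ∸ ((i + e) + (i + e) + 1)
    ∎
    where
    open ≡-Reasoning
    regroup : ∀ b e → (b + e) + b ≡ e + (b + b)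
    regroup = solve-∀
    c≡ : ∀ e i → i + (i + e) + 1 ≡ e + (i + i + 1)
    c≡ = solve-∀
    a+a≡ : ∀ b e → (b + e) + (b + e) ≡ (e + e) + (b + b)
    a+a≡ = solve-∀
    hi≡ : ∀ e i → (i + e) + (i + e) + 1 ≡ (e + e) + (i + i + 1)
    hi≡ = solve-∀
  a+c∸b : (a + c) ∸ b ≡ (i + e) + (i + e) + 1
  a+c∸b = trans (cong (_∸ b) (+-assoc b e c)) (trans (m+n∸m≡n b (e + c)) (e+c≡ e i))
    where
    e+c≡ : ∀ e i → e + (i + (i + e) + 1) ≡ (i + e) + (i + e) + 1
    e+c≡ = solve-∀
  b+c∸a : (b + c) ∸ a ≡ i + i + 1
  b+c∸a = trans (cong (_∸ a) b+c≡a+lo) (m+n∸m≡n a (i + i + 1))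
  heron≡ : heron a b c ≡ heronPair a (i + i + 1) ((i + e) + (i + e) + 1)
  heron≡ = cong₂ _*_ (cong₂ _*_ (cong₂ _*_ perimeter a+b∸c) a+c∸b) b+c∸a

odd-prime : ∀ u → Prime u → 2 < u → Σ ℕ λ i → u ≡ i + i + 1
odd-prime u u-prime 2<u with u % 2 in u%2≡ | m%n<n u 2
... | zero        | _ = ⊥-elim (<⇒≢ 2<u (2≡u (m%n≡0⇒n∣m u 2 u%2≡)))
  where
  2≡u : 2 ∣ u → 2 ≡ u
  2≡u 2∣u with prime⇒irreducible u-prime 2∣u
  ... | inj₁ ()
  ... | inj₂ 2≡u = 2≡u
... | suc zero    | _ = u / 2 , trans (m≡m%n+[m/n]*n u 2) (trans (cong (_+ (u / 2) * 2) u%2≡) (odd (u / 2)))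
  where
  odd : ∀ x → 1 + x * 2 ≡ x + x + 1
  odd = solve-∀
... | suc (suc _) | s≤s (s≤s ())

pairTriangle : ∀ d lo hi i k → lo ≡ i + i + 1 → hi ≡ k + k + 1 → lo < hi → hi ≤ d →
  Σ ℕ λ a → Σ ℕ λ b → Σ ℕ λ c → NonDegTriangle a b c × (a ⊔ b ⊔ c ≡ d) × heron a b c ≡ heronPair d lo hi
pairTriangle d lo hi i k refl refl lo<hi hi≤d = triangle (k ∸ i) (d ∸ (k ∸ i)) (m+[n∸m]≡n i≤k) (m∸n+n≡m e≤d)
  where
  i<k : i < k
  i<k with i <? k
  ... | yes i<k = i<k
  ... | no i≮k = ⊥-elim (<⇒≱ lo<hi (+-monoˡ-≤ 1 (+-mono-≤ (≮⇒≥ i≮k) (≮⇒≥ i≮k))))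
  i≤k = <⇒≤ i<k
  e≤d : k ∸ i ≤ d
  e≤d = ≤-trans (m∸n≤m k i) (≤-trans (≤-trans (m≤m+n k k) (m≤m+n (k + k) 1)) hi≤d)
  triangle : ∀ e b → i + e ≡ k → b + e ≡ d → Σ ℕ λ a → Σ ℕ λ b → Σ ℕ λ c →
    NonDegTriangle a b c × (a ⊔ b ⊔ c ≡ d) × heron a b c ≡ heronPair d (i + i + 1) (k + k + 1)
  triangle e b refl refl with pairTriangle-shape b e i (+-cancelˡ-≤ i 1 e (subst (_≤ i + e) (+-comm 1 i) i<k)) hi≤d
  ... | triangle , max≡ , heron≡ = b + e , b , i + (i + e) + 1 , triangle , max≡ , heron≡

∤*∤*∤ : ∀ p A B C → Prime p → ¬ (p ∣ A) → ¬ (p ∣ B) → ¬ (p ∣ C) → ¬ (p ∣ A * B * C)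
∤*∤*∤ p A B C p-prime p∤A p∤B p∤C p∣ABC with euclidsLemma (A * B) C p-prime p∣ABC
... | inj₂ p∣C  = p∤C p∣C
... | inj₁ p∣AB with euclidsLemma A B p-prime p∣AB
...   | inj₁ p∣A = p∤A p∣A
...   | inj₂ p∣B = p∤B p∣B

prime∣*⁴ : ∀ p A B C E → Prime p → p ∣ A * B * C * E → p ∣ A ⊎ p ∣ B ⊎ p ∣ C ⊎ p ∣ E
prime∣*⁴ p A B C E p-prime p∣ with euclidsLemma (A * B * C) E p-prime p∣
... | inj₂ p∣E   = inj₂ (inj₂ (inj₂ p∣E))
... | inj₁ p∣ABC with euclidsLemma (A * B) C p-prime p∣ABC
...   | inj₂ p∣C  = inj₂ (inj₂ (inj₁ p∣C))
...   | inj₁ p∣AB with euclidsLemma A B p-prime p∣AB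
...     | inj₁ p∣A = inj₁ p∣A
...     | inj₂ p∣B = inj₂ (inj₁ p∣B)

prime∣prime⇒≡ : ∀ {p q} → Prime p → Prime q → p ∣ q → p ≡ q
prime∣prime⇒≡ {p} {q} p-prime q-prime p∣q with prime⇒irreducible q-prime p∣q
... | inj₁ refl = ⊥-elim (<-irrefl refl (nonTrivial⇒n>1 1 {{prime⇒nonTrivial p-prime}}))
... | inj₂ p≡q  = p≡q

∤X⇒∣squarefreePart : ∀ p X k m → Prime p → ¬ (p ∣ X) → X * p ≡ k * (m * m) → p ∣ k
∤X⇒∣squarefreePart p X k m p-prime p∤X Xp≡km² with p ∣? k
... | yes p∣k = p∣k
... | no p∤k  = ⊥-elim (p∤X p∣X)
  where
  instance _ = prime⇒nonZero p-prime
  p∣m : p ∣ m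
  p∣m with euclidsLemma k (m * m) p-prime (divides X (sym Xp≡km²))
  ... | inj₁ p∣k  = ⊥-elim (p∤k p∣k)
  ... | inj₂ p∣m² with euclidsLemma m m p-prime p∣m²
  ...   | inj₁ p∣m = p∣m
  ...   | inj₂ p∣m = p∣m
  p∣X : p ∣ X
  p∣X with p∣m
  ... | divides q refl = divides (k * q * q) (*-cancelʳ-≡ X (k * q * q * p) p (trans Xp≡km² (regroup k q p)))
    where
    regroup : ∀ k q p → k * (q * p * (q * p)) ≡ k * q * q * p * p
    regroup = solve-∀

length-++⁴ : ∀ {A : Set} (a b c e : List A) → length (a ++ (b ++ (c ++ e))) ≡ length a + (length b + (length c + length e))
length-++⁴ a b c e = trans (length-++ a) (cong (length a +_) (trans (length-++ b) (cong (length b +_) (length-++ c))))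

compare-⊓⊔ : ∀ u v → u ≢ v → (u ⊓ v ≡ u × u ⊔ v ≡ v × u < v) ⊎ (u ⊓ v ≡ v × u ⊔ v ≡ u × v < u)
compare-⊓⊔ u v u≢v with <-cmp u v
... | tri< u<v _ _ = inj₁ (m≤n⇒m⊓n≡m (<⇒≤ u<v) , m≤n⇒m⊔n≡n (<⇒≤ u<v) , u<v)
... | tri≈ _ u≡v _ = ⊥-elim (u≢v u≡v)
... | tri> _ _ v<u = inj₂ (m≥n⇒m⊓n≡n (<⇒≤ v<u) , m≥n⇒m⊔n≡m (<⇒≤ v<u) , v<u)

-- A prime of S dividing the characteristic of a Good pair is one of the 2398 candidates of the pair,
-- and both members of the pair are among the candidates of any Good pair with the same characteristic:
-- so a characteristic arises from at most 2398² Good pairs, while there are at least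
-- |S′|(|S′| − 2399) Good pairs.
module LowerBound (d n : ℕ) (2≤n : 2 ≤ n) (64n≤d : 64 * n ≤ d) (d<256n : d < 256 * n) where

  2d = d + d

  32n≤d : 32 * n ≤ d
  32n≤d = ≤-trans (*-monoˡ-≤ n (≤ᵇ⇒≤ 32 64 _)) 64n≤d

  d>0 : 0 < d
  d>0 = ≤-trans (≤-trans (≤-trans (s≤s z≤n) 2≤n) (m≤n*m n 64)) 64n≤d

  2d+x<600n : ∀ x → x ≤ 32 * n → 2d + x < 600 * n
  2d+x<600n x x≤32n = begin-strict
      d + d + x                   <⟨ +-mono-<-≤ (+-mono-< d<256n d<256n) x≤32n ⟩
      256 * n + 256 * n + 32 * n  ≡⟨ collect 256 256 32 n ⟩
      544 * n                     ≤⟨ *-monoˡ-≤ n (≤ᵇ⇒≤ 544 600 _) ⟩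
      600 * n                     ∎
    where
    open ≤-Reasoning
    collect : ∀ a b c n → a * n + b * n + c * n ≡ (a + b + c) * n
    collect = solve-∀

  2d<600n : 2d < 600 * n
  2d<600n = ≤-<-trans (≤-reflexive (sym (+-identityʳ 2d))) (2d+x<600n 0 z≤n)

  2d∸x<600n : ∀ x → 2d ∸ x < 600 * n
  2d∸x<600n x = ≤-<-trans (m∸n≤m 2d x) 2d<600n

  S : List ℕ
  S = primesIn n (32 * n)

  S! : Unique S
  S! = primesIn-unique n (32 * n)

  ∈S⇒prime : ∀ {p} → p ∈ S → Prime p
  ∈S⇒prime p∈ = proj₁ (∈-primesIn⁻ n (32 * n) p∈)

  ∈S⇒n< : ∀ {p} → p ∈ S → n < p
  ∈S⇒n< p∈ = proj₁ (proj₂ (∈-primesIn⁻ n (32 * n) p∈))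

  ∈S⇒≤32n : ∀ {p} → p ∈ S → p ≤ 32 * n
  ∈S⇒≤32n p∈ = proj₂ (proj₂ (∈-primesIn⁻ n (32 * n) p∈))

  ∈S⇒<2d : ∀ {p} → p ∈ S → p < 2d
  ∈S⇒<2d p∈ = ≤-<-trans (≤-trans (∈S⇒≤32n p∈) 32n≤d) (m<m+n d d>0)

  ∈S⇒>0 : ∀ {p} → p ∈ S → 0 < p
  ∈S⇒>0 p∈ = prime>0 (∈S⇒prime p∈)

  -- For X < 600 n, every divisor of X above n has cofactor below 600.
  opaque
    bigDivisors : ℕ → List ℕ
    bigDivisors X = map (λ m → X / suc m) (upTo 599)

    length-bigDivisors : ∀ X → length (bigDivisors X) ≡ 599
    length-bigDivisors X = trans (length-map (λ m → X / suc m) (upTo 599)) (length-upTo 599)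

    X/[1+m]∈bigDivisors : ∀ X m → m < 599 → X / suc m ∈ bigDivisors X
    X/[1+m]∈bigDivisors X m m<599 = ∈-map⁺ (λ m → X / suc m) (∈-upTo⁺ m<599)

  ∣⇒∈bigDivisors : ∀ p X → n < p → 0 < X → X < 600 * n → p ∣ X → p ∈ bigDivisors X
  ∣⇒∈bigDivisors p X n<p X>0 X<600n (divides zero refl) = ⊥-elim (<-irrefl refl X>0)
  ∣⇒∈bigDivisors p X n<p X>0 X<600n (divides (suc m) refl) =
    subst (_∈ bigDivisors X) (m*n/n≡m p (suc m))
      (subst (λ t → t / suc m ∈ bigDivisors X) (*-comm (suc m) p) (X/[1+m]∈bigDivisors X m m<599))
    where
    m<599 : m < 599
    m<599 = s≤s⁻¹ (*-cancelʳ-< n (suc m) 600 (≤-<-trans (*-monoʳ-≤ (suc m) (<⇒≤ n<p)) X<600n))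

  Good : ℕ → ℕ → Set
  Good u v = u ≢ v × ¬ (u ∣ 2d) × ¬ (v ∣ 2d) × ¬ (u ∣ 2d ∸ v) × ¬ (v ∣ 2d ∸ u) × ¬ (u ∣ 2d + v) × ¬ (v ∣ 2d + u)

  Good? : ∀ (g : ℕ × ℕ) → Dec (Good (proj₁ g) (proj₂ g))
  Good? (u , v) = ¬? (u ≟ v) ×-dec ¬? (u ∣? 2d) ×-dec ¬? (v ∣? 2d) ×-dec ¬? (u ∣? 2d ∸ v)
           ×-dec ¬? (v ∣? 2d ∸ u) ×-dec ¬? (u ∣? 2d + v) ×-dec ¬? (v ∣? 2d + u)

  heronPair>0 : ∀ lo hi → lo ∈ S → hi ∈ S → 0 < heronPair d lo hi
  heronPair>0 lo hi lo∈ hi∈ =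
    *-mono-≤ (*-mono-≤ (*-mono-≤ (≤-trans (∈S⇒>0 lo∈) (m≤n+m lo 2d)) (m<n⇒0<n∸m (∈S⇒<2d hi∈))) (∈S⇒>0 hi∈)) (∈S⇒>0 lo∈)

  ∣sqf-heronPair : ∀ lo hi → lo ∈ S → hi ∈ S → lo ≢ hi →
    ¬ (lo ∣ 2d) → ¬ (lo ∣ 2d ∸ hi) → ¬ (hi ∣ 2d + lo) → ¬ (hi ∣ 2d) →
    lo ∣ sqf (heronPair d lo hi) × hi ∣ sqf (heronPair d lo hi)
  ∣sqf-heronPair lo hi lo∈ hi∈ lo≢hi lo∤2d lo∤2d∸hi hi∤2d+lo hi∤2d
    with sqf-isSquarefreePart (heronPair d lo hi) (heronPair>0 lo hi lo∈ hi∈)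
  ... | _ , m , H≡km² =
    ∤X⇒∣squarefreePart lo ((2d + lo) * (2d ∸ hi) * hi) _ m lo-prime lo∤rest H≡km² ,
    ∤X⇒∣squarefreePart hi ((2d + lo) * (2d ∸ hi) * lo) _ m hi-prime hi∤rest (trans (swap (2d + lo) (2d ∸ hi) hi lo) H≡km²)
    where
    lo-prime = ∈S⇒prime lo∈
    hi-prime = ∈S⇒prime hi∈
    swap : ∀ a b c e → a * b * e * c ≡ a * b * c * e
    swap = solve-∀
    lo∤rest : ¬ (lo ∣ (2d + lo) * (2d ∸ hi) * hi)
    lo∤rest = ∤*∤*∤ lo _ _ _ lo-prime (λ lo∣ → lo∤2d (∣m+n∣m⇒∣n (subst (lo ∣_) (+-comm 2d lo) lo∣) ∣-refl))
                lo∤2d∸hi (λ lo∣hi → lo≢hi (prime∣prime⇒≡ lo-prime hi-prime lo∣hi))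
    hi∤rest : ¬ (hi ∣ (2d + lo) * (2d ∸ hi) * lo)
    hi∤rest = ∤*∤*∤ hi _ _ _ hi-prime hi∤2d+lo (λ hi∣ → hi∤2d (∣m∸n∣n⇒∣m hi (<⇒≤ (∈S⇒<2d hi∈)) hi∣ ∣-refl))
                (λ hi∣lo → lo≢hi (sym (prime∣prime⇒≡ hi-prime lo-prime hi∣lo)))

  ∣sqf-heronPair⇒ : ∀ {p lo hi} → p ∈ S → lo ∈ S → hi ∈ S → p ∣ sqf (heronPair d lo hi) →
    p ≡ lo ⊎ p ≡ hi ⊎ p ∈ bigDivisors (2d + lo) ⊎ p ∈ bigDivisors (2d ∸ hi)
  ∣sqf-heronPair⇒ {p} {lo} {hi} p∈ lo∈ hi∈ p∣k with sqf-isSquarefreePart (heronPair d lo hi) (heronPair>0 lo hi lo∈ hi∈)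
  ... | _ , m , H≡km²
      with prime∣*⁴ p (2d + lo) (2d ∸ hi) hi lo (∈S⇒prime p∈)
             (subst (p ∣_) (sym H≡km²) (∣-trans p∣k (∣m⇒∣m*n (m * m) ∣-refl)))
  ... | inj₁ p∣ = inj₂ (inj₂ (inj₁ (∣⇒∈bigDivisors p _ (∈S⇒n< p∈) (≤-trans (∈S⇒>0 lo∈) (m≤n+m lo 2d))
                                      (2d+x<600n lo (∈S⇒≤32n lo∈)) p∣)))
  ... | inj₂ (inj₁ p∣) = inj₂ (inj₂ (inj₂ (∣⇒∈bigDivisors p _ (∈S⇒n< p∈) (m<n⇒0<n∸m (∈S⇒<2d hi∈)) (2d∸x<600n hi) p∣)))
  ... | inj₂ (inj₂ (inj₁ p∣hi)) = inj₂ (inj₁ (prime∣prime⇒≡ (∈S⇒prime p∈) (∈S⇒prime hi∈) p∣hi))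
  ... | inj₂ (inj₂ (inj₂ p∣lo)) = inj₁ (prime∣prime⇒≡ (∈S⇒prime p∈) (∈S⇒prime lo∈) p∣lo)

  sqf-heronPair-isChar : ∀ {lo hi} → lo ∈ S → hi ∈ S → lo < hi → IsCharOfLargest d (sqf (heronPair d lo hi))
  sqf-heronPair-isChar {lo} {hi} lo∈ hi∈ lo<hi
    with odd-prime lo (∈S⇒prime lo∈) (≤-<-trans 2≤n (∈S⇒n< lo∈))
       | odd-prime hi (∈S⇒prime hi∈) (≤-<-trans 2≤n (∈S⇒n< hi∈))
  ... | i , lo≡ | k , hi≡ with pairTriangle d lo hi i k lo≡ hi≡ lo<hi (≤-trans (∈S⇒≤32n hi∈) 32n≤d)
  ... | a , b , c , triangle , max≡d , heron≡ = a , b , c , triangle , max≡d ,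
    subst (λ t → IsSquarefreePart t (sqf (heronPair d lo hi))) (sym heron≡) (sqf-isSquarefreePart _ (heronPair>0 lo hi lo∈ hi∈))

  charOf : ℕ × ℕ → ℕ
  charOf (u , v) = sqf (heronPair d (u ⊓ v) (u ⊔ v))

  charOf-isChar : ∀ {u v} → u ∈ S → v ∈ S → Good u v → IsCharOfLargest d (charOf (u , v))
  charOf-isChar {u} {v} u∈ v∈ (u≢v , _) with compare-⊓⊔ u v u≢v
  ... | inj₁ (⊓≡ , ⊔≡ , u<v) rewrite ⊓≡ | ⊔≡ = sqf-heronPair-isChar u∈ v∈ u<v
  ... | inj₂ (⊓≡ , ⊔≡ , v<u) rewrite ⊓≡ | ⊔≡ = sqf-heronPair-isChar v∈ u∈ v<u

  ∣charOf : ∀ {u v} → u ∈ S → v ∈ S → Good u v → u ∣ charOf (u , v) × v ∣ charOf (u , v)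
  ∣charOf {u} {v} u∈ v∈ (u≢v , u∤2d , v∤2d , u∤2d∸v , v∤2d∸u , u∤2d+v , v∤2d+u) with compare-⊓⊔ u v u≢v
  ... | inj₁ (⊓≡ , ⊔≡ , _) rewrite ⊓≡ | ⊔≡ = ∣sqf-heronPair u v u∈ v∈ u≢v u∤2d u∤2d∸v v∤2d+u v∤2d
  ... | inj₂ (⊓≡ , ⊔≡ , _) rewrite ⊓≡ | ⊔≡ =
    let v∣ , u∣ = ∣sqf-heronPair v u v∈ u∈ (u≢v ∘ sym) v∤2d v∤2d∸u u∤2d+v u∤2d in u∣ , v∣

  opaque
    candidates : ℕ × ℕ → List ℕ
    candidates (u , v) = u ∷ v ∷ (bigDivisors (2d + u) ++ (bigDivisors (2d + v) ++ (bigDivisors (2d ∸ u) ++ bigDivisors (2d ∸ v))))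

    length-candidates : ∀ g → length (candidates g) ≡ 2398
    length-candidates (u , v) = cong (λ t → suc (suc t)) (begin
        length (bigDivisors (2d + u) ++ (bigDivisors (2d + v) ++ (bigDivisors (2d ∸ u) ++ bigDivisors (2d ∸ v))))
      ≡⟨ length-++⁴ (bigDivisors (2d + u)) (bigDivisors (2d + v)) (bigDivisors (2d ∸ u)) (bigDivisors (2d ∸ v)) ⟩
        length (bigDivisors (2d + u)) + (length (bigDivisors (2d + v)) + (length (bigDivisors (2d ∸ u)) + length (bigDivisors (2d ∸ v))))
      ≡⟨ cong₂ _+_ (length-bigDivisors _) (cong₂ _+_ (length-bigDivisors _) (cong₂ _+_ (length-bigDivisors _) (length-bigDivisors _))) ⟩
        2396
      ∎)
      where open ≡-Reasoning

    ∈candidates-u : ∀ u v → u ∈ candidates (u , v)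
    ∈candidates-u u v = here refl
    ∈candidates-v : ∀ u v → v ∈ candidates (u , v)
    ∈candidates-v u v = there (here refl)
    ∈candidates-2d+u : ∀ {x} u v → x ∈ bigDivisors (2d + u) → x ∈ candidates (u , v)
    ∈candidates-2d+u u v x∈ = there (there (∈-++⁺ˡ x∈))
    ∈candidates-2d+v : ∀ {x} u v → x ∈ bigDivisors (2d + v) → x ∈ candidates (u , v)
    ∈candidates-2d+v u v x∈ = there (there (∈-++⁺ʳ (bigDivisors (2d + u)) (∈-++⁺ˡ x∈)))
    ∈candidates-2d∸u : ∀ {x} u v → x ∈ bigDivisors (2d ∸ u) → x ∈ candidates (u , v)
    ∈candidates-2d∸u u v x∈ = there (there (∈-++⁺ʳ (bigDivisors (2d + u)) (∈-++⁺ʳ (bigDivisors (2d + v)) (∈-++⁺ˡ x∈))))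
    ∈candidates-2d∸v : ∀ {x} u v → x ∈ bigDivisors (2d ∸ v) → x ∈ candidates (u , v)
    ∈candidates-2d∸v u v x∈ =
      there (there (∈-++⁺ʳ (bigDivisors (2d + u)) (∈-++⁺ʳ (bigDivisors (2d + v)) (∈-++⁺ʳ (bigDivisors (2d ∸ u)) x∈))))

  ∣charOf⇒∈candidates : ∀ {p u v} → p ∈ S → u ∈ S → v ∈ S → Good u v → p ∣ charOf (u , v) → p ∈ candidates (u , v)
  ∣charOf⇒∈candidates {p} {u} {v} p∈ u∈ v∈ (u≢v , _) p∣ with compare-⊓⊔ u v u≢v
  ... | inj₁ (⊓≡ , ⊔≡ , _) rewrite ⊓≡ | ⊔≡ with ∣sqf-heronPair⇒ p∈ u∈ v∈ p∣
  ...   | inj₁ refl               = ∈candidates-u u v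
  ...   | inj₂ (inj₁ refl)        = ∈candidates-v u v
  ...   | inj₂ (inj₂ (inj₁ p∈′))  = ∈candidates-2d+u u v p∈′
  ...   | inj₂ (inj₂ (inj₂ p∈′))  = ∈candidates-2d∸v u v p∈′
  ∣charOf⇒∈candidates {p} {u} {v} p∈ u∈ v∈ (u≢v , _) p∣ | inj₂ (⊓≡ , ⊔≡ , _) rewrite ⊓≡ | ⊔≡
    with ∣sqf-heronPair⇒ p∈ v∈ u∈ p∣
  ...   | inj₁ refl               = ∈candidates-v u v
  ...   | inj₂ (inj₁ refl)        = ∈candidates-u u v
  ...   | inj₂ (inj₂ (inj₁ p∈′))  = ∈candidates-2d+v u v p∈′
  ...   | inj₂ (inj₂ (inj₂ p∈′))  = ∈candidates-2d∸u u v p∈′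

  S′ : List ℕ
  S′ = filter (λ u → ¬? (u ∣? 2d)) S

  S′! : Unique S′
  S′! = Unique.filter⁺ (λ u → ¬? (u ∣? 2d)) S!

  ∈S′⁻ : ∀ {u} → u ∈ S′ → u ∈ S × ¬ (u ∣ 2d)
  ∈S′⁻ u∈ = ∈-filter⁻ (λ u → ¬? (u ∣? 2d)) {xs = S} u∈

  |S|∸599≤|S′| : length S ∸ 599 ≤ length S′
  |S|∸599≤|S′| = subst (λ t → length S ∸ t ≤ length S′) (length-bigDivisors 2d)
    (length∸length≤length-filter (λ u → ¬? (u ∣? 2d)) S (bigDivisors 2d) S!
      (λ {x} x∈ ¬x∤2d → ∣⇒∈bigDivisors x 2d (∈S⇒n< x∈) (≤-trans d>0 (m≤m+n d d)) 2d<600n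
                          (decidable-stable (x ∣? 2d) ¬x∤2d)))

  -- The partners v making (u, v) not Good, beyond u itself and those dividing 2d (excluded from S′).
  opaque
    badPartners : ℕ → List ℕ
    badPartners u = u ∷ (bigDivisors (2d ∸ u) ++ (bigDivisors (2d + u) ++
                        (map (λ m → 2d ∸ u * m) (upTo 600) ++ map (λ m → u * m ∸ 2d) (upTo 600))))

    length-badPartners : ∀ u → length (badPartners u) ≡ 2399
    length-badPartners u = cong suc (trans
      (length-++⁴ (bigDivisors (2d ∸ u)) (bigDivisors (2d + u)) (map (λ m → 2d ∸ u * m) (upTo 600)) (map (λ m → u * m ∸ 2d) (upTo 600)))
      (cong₂ _+_ (length-bigDivisors _) (cong₂ _+_ (length-bigDivisors _)
        (cong₂ _+_ (length-map-upTo (λ m → 2d ∸ u * m)) (length-map-upTo (λ m → u * m ∸ 2d))))))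
      where
      length-map-upTo : ∀ (f : ℕ → ℕ) → length (map f (upTo 600)) ≡ 600
      length-map-upTo f = trans (length-map f (upTo 600)) (length-upTo 600)

    ∈badPartners-u : ∀ u → u ∈ badPartners u
    ∈badPartners-u u = here refl
    ∈badPartners-2d∸u : ∀ {x} u → x ∈ bigDivisors (2d ∸ u) → x ∈ badPartners u
    ∈badPartners-2d∸u u x∈ = there (∈-++⁺ˡ x∈)
    ∈badPartners-2d+u : ∀ {x} u → x ∈ bigDivisors (2d + u) → x ∈ badPartners u
    ∈badPartners-2d+u u x∈ = there (∈-++⁺ʳ (bigDivisors (2d ∸ u)) (∈-++⁺ˡ x∈))
    ∈badPartners-2d∸uq : ∀ u q → q < 600 → 2d ∸ u * q ∈ badPartners u
    ∈badPartners-2d∸uq u q q<600 = there (∈-++⁺ʳ (bigDivisors (2d ∸ u)) (∈-++⁺ʳ (bigDivisors (2d + u))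
      (∈-++⁺ˡ (∈-map⁺ (λ m → 2d ∸ u * m) (∈-upTo⁺ q<600)))))
    ∈badPartners-uq∸2d : ∀ u q → q < 600 → u * q ∸ 2d ∈ badPartners u
    ∈badPartners-uq∸2d u q q<600 = there (∈-++⁺ʳ (bigDivisors (2d ∸ u)) (∈-++⁺ʳ (bigDivisors (2d + u))
      (∈-++⁺ʳ (map (λ m → 2d ∸ u * m) (upTo 600)) (∈-map⁺ (λ m → u * m ∸ 2d) (∈-upTo⁺ q<600)))))

  cofactor<600 : ∀ {u q X} → u ∈ S → X ≡ q * u → X < 600 * n → q < 600
  cofactor<600 {u} {q} u∈ X≡qu X<600n =
    *-cancelʳ-< n q 600 (≤-<-trans (*-monoʳ-≤ q (<⇒≤ (∈S⇒n< u∈))) (subst (_< 600 * n) X≡qu X<600n))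

  ¬Good⇒∈badPartners : ∀ {u v} → u ∈ S′ → v ∈ S′ → ¬ Good u v → v ∈ badPartners u
  ¬Good⇒∈badPartners {u} {v} u∈′ v∈′ ¬good with ∈S′⁻ u∈′ | ∈S′⁻ v∈′
  ... | u∈ , u∤2d | v∈ , v∤2d with u ≟ v
  ... | yes refl = ∈badPartners-u u
  ... | no u≢v with v ∣? 2d ∸ u
  ... | yes v∣ = ∈badPartners-2d∸u u (∣⇒∈bigDivisors v _ (∈S⇒n< v∈) (m<n⇒0<n∸m (∈S⇒<2d u∈)) (2d∸x<600n u) v∣)
  ... | no v∤2d∸u with v ∣? 2d + u
  ... | yes v∣ = ∈badPartners-2d+u u (∣⇒∈bigDivisors v _ (∈S⇒n< v∈) (≤-trans (∈S⇒>0 u∈) (m≤n+m u 2d))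
                                        (2d+x<600n u (∈S⇒≤32n u∈)) v∣)
  ... | no v∤2d+u with u ∣? 2d ∸ v
  ... | yes (divides q 2d∸v≡qu) = subst (_∈ badPartners u) 2d∸uq≡v
          (∈badPartners-2d∸uq u q (cofactor<600 u∈ 2d∸v≡qu (2d∸x<600n v)))
    where
    2d∸uq≡v : 2d ∸ u * q ≡ v
    2d∸uq≡v = trans (cong (2d ∸_) (trans (*-comm u q) (sym 2d∸v≡qu))) (m∸[m∸n]≡n (<⇒≤ (∈S⇒<2d v∈)))
  ... | no u∤2d∸v with u ∣? 2d + v
  ... | yes (divides q 2d+v≡qu) = subst (_∈ badPartners u) uq∸2d≡v
          (∈badPartners-uq∸2d u q (cofactor<600 u∈ 2d+v≡qu (2d+x<600n v (∈S⇒≤32n v∈))))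
    where
    uq∸2d≡v : u * q ∸ 2d ≡ v
    uq∸2d≡v = trans (cong (_∸ 2d) (trans (*-comm u q) (sym 2d+v≡qu))) (m+n∸m≡n 2d v)
  ... | no u∤2d+v = ⊥-elim (¬good (u≢v , u∤2d , v∤2d , u∤2d∸v , v∤2d∸u , u∤2d+v , v∤2d+u))

  goodPairs : List (ℕ × ℕ)
  goodPairs = filter Good? (cartesianProduct S′ S′)

  ∈goodPairs⁻ : ∀ {u v} → (u , v) ∈ goodPairs → u ∈ S × v ∈ S × Good u v
  ∈goodPairs⁻ {u} {v} uv∈ with ∈-filter⁻ Good? {xs = cartesianProduct S′ S′} uv∈
  ... | uv∈S′² , good with ∈-cartesianProduct⁻ S′ S′ uv∈S′²
  ... | u∈′ , v∈′ = proj₁ (∈S′⁻ u∈′) , proj₁ (∈S′⁻ v∈′) , good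

  |S′|*[|S′|∸2399]≤|goodPairs| : length S′ * (length S′ ∸ 2399) ≤ length goodPairs
  |S′|*[|S′|∸2399]≤|goodPairs| = length*c≤length-filter-cartesianProduct Good? S′ S′ (length S′ ∸ 2399) λ {u} u∈′ →
    subst (λ t → length S′ ∸ t ≤ length (filter (λ v → Good? (u , v)) S′)) (length-badPartners u)
      (length∸length≤length-filter (λ v → Good? (u , v)) S′ (badPartners u) S′! (¬Good⇒∈badPartners u∈′))

  |goodPairs|≤2398²*|L| : ∀ (L : List ℕ) → EnumeratesChars d L → length goodPairs ≤ (2398 * 2398) * length L
  |goodPairs|≤2398²*|L| L (_ , L↔) = length≤bound*length-image charOf (2398 * 2398) L goodPairs
    (Unique.filter⁺ Good? (Unique.cartesianProduct⁺ S′! S′!)) charOf∈L fibre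
    where
    charOf∈L : ∀ {g} → g ∈ goodPairs → charOf g ∈ L
    charOf∈L {u , v} uv∈ = let u∈ , v∈ , good = ∈goodPairs⁻ uv∈ in
      Equivalence.from (L↔ (charOf (u , v))) (charOf-isChar u∈ v∈ good)
    fibre : ∀ {g₀} → g₀ ∈ goodPairs →
      Σ (List (ℕ × ℕ)) λ C → length C ≤ 2398 * 2398 × (∀ {g} → g ∈ goodPairs → charOf g ≡ charOf g₀ → g ∈ C)
    fibre {u₀ , v₀} g₀∈ = cartesianProduct (candidates (u₀ , v₀)) (candidates (u₀ , v₀)) ,
      ≤-reflexive (trans (length-cartesianProduct (candidates (u₀ , v₀)) (candidates (u₀ , v₀)))
        (cong₂ _*_ (length-candidates (u₀ , v₀)) (length-candidates (u₀ , v₀)))) ,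
      λ { {u , v} uv∈ char≡ → let u∈ , v∈ , good = ∈goodPairs⁻ uv∈ ; u∣ , v∣ = ∣charOf u∈ v∈ good in
          ∈-cartesianProduct⁺ (∣charOf⇒∈candidates u∈ u₀∈ v₀∈ good₀ (subst (u ∣_) char≡ u∣))
                              (∣charOf⇒∈candidates v∈ u₀∈ v₀∈ good₀ (subst (v ∣_) char≡ v∣)) }
      where
      u₀∈ = proj₁ (∈goodPairs⁻ g₀∈)
      v₀∈ = proj₁ (proj₂ (∈goodPairs⁻ g₀∈))
      good₀ = proj₂ (proj₂ (∈goodPairs⁻ g₀∈))

2^m≤n⇒m≤⌊log₂n⌋ : ∀ m n → 2 ^ m ≤ n → m ≤ ⌊log₂ n ⌋
2^m≤n⇒m≤⌊log₂n⌋ m n 2^m≤n = subst (_≤ ⌊log₂ n ⌋) (⌊log₂[2^n]⌋≡n m) (⌊log₂⌋-mono-≤ 2^m≤n)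

n<2^[1+⌊log₂n⌋] : ∀ n → n < 2 ^ suc ⌊log₂ n ⌋
n<2^[1+⌊log₂n⌋] n with n <? 2 ^ suc ⌊log₂ n ⌋
... | yes n< = n<
... | no n≮ = ⊥-elim (<⇒≱ (n<1+n ⌊log₂ n ⌋) (2^m≤n⇒m≤⌊log₂n⌋ (suc ⌊log₂ n ⌋) n (≮⇒≥ n≮)))

2^⌊log₂n⌋≤n : ∀ n → 0 < n → 2 ^ ⌊log₂ n ⌋ ≤ n
2^⌊log₂n⌋≤n n = go n n ≤-refl
  where
  go : ∀ fuel n → n ≤ fuel → 0 < n → 2 ^ ⌊log₂ n ⌋ ≤ n
  go fuel       (suc zero)    _ _ = subst (λ t → 2 ^ t ≤ 1) (sym (⌊log₂[2^n]⌋≡n 0)) ≤-refl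
  go (suc fuel) (suc (suc m)) 2+m≤fuel _ = begin
      2 ^ lg
    ≡⟨ cong (2 ^_) (m+[n∸m]≡n lg>0) ⟨
      2 * 2 ^ (lg ∸ 1)
    ≡⟨ cong (λ t → 2 * 2 ^ t) (⌊log₂⌊n/2⌋⌋≡⌊log₂n⌋∸1 (suc (suc m))) ⟨
      2 * 2 ^ ⌊log₂ h ⌋
    ≤⟨ *-monoʳ-≤ 2 (go fuel h (≤-trans (s≤s⁻¹ (⌊n/2⌋<n (suc m))) (s≤s⁻¹ 2+m≤fuel)) (s≤s z≤n)) ⟩
      2 * h
    ≡⟨ cong (h +_) (+-identityʳ h) ⟩
      h + h
    ≤⟨ +-monoʳ-≤ h (⌊n/2⌋≤⌈n/2⌉ (suc (suc m))) ⟩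
      h + ⌈ suc (suc m) /2⌉
    ≡⟨ ⌊n/2⌋+⌈n/2⌉≡n (suc (suc m)) ⟩
      suc (suc m)
    ∎
    where
    open ≤-Reasoning
    lg = ⌊log₂ (suc (suc m)) ⌋
    h = ⌊ suc (suc m) /2⌋
    lg>0 : 0 < lg
    lg>0 = 2^m≤n⇒m≤⌊log₂n⌋ 1 (suc (suc m)) (s≤s (s≤s z≤n))

[j+5]*c≤9*2^j : ∀ c → 19 * c ≤ 9 * 2 ^ 14 → ∀ j → 14 ≤ j → (j + 5) * c ≤ 9 * 2 ^ j
[j+5]*c≤9*2^j c base j 14≤j = subst (λ t → (t + 5) * c ≤ 9 * 2 ^ t) (m∸n+n≡m 14≤j) (go (j ∸ 14))
  where
  go : ∀ k → (k + 14 + 5) * c ≤ 9 * 2 ^ (k + 14)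
  go zero    = base
  go (suc k) = begin
      (suc (k + 14) + 5) * c
    ≡⟨ step (k + 14) c ⟩
      (k + 14 + 5) * c + c
    ≤⟨ +-mono-≤ (go k) (≤-trans (m≤n*m c (k + 14 + 5) {{>-nonZero (≤-trans (s≤s z≤n) (m≤n+m 5 (k + 14)))}}) (go k)) ⟩
      9 * 2 ^ (k + 14) + 9 * 2 ^ (k + 14)
    ≡⟨ double (2 ^ (k + 14)) ⟩
      9 * 2 ^ suc (k + 14)
    ∎
    where
    open ≤-Reasoning
    step : ∀ x c → (suc x + 5) * c ≡ (x + 5) * c + c
    step = solve-∀
    double : ∀ y → 9 * y + 9 * y ≡ 9 * (2 * y)
    double = solve-∀

s≤2*[s∸c] : ∀ s c → c + c ≤ s → s ≤ (s ∸ c) + (s ∸ c)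
s≤2*[s∸c] s c 2c≤s = begin
    s                     ≡⟨ s∸c+c≡s ⟨
    (s ∸ c) + c           ≤⟨ +-monoʳ-≤ (s ∸ c) (+-cancelʳ-≤ c c (s ∸ c) (subst (c + c ≤_) (sym s∸c+c≡s) 2c≤s)) ⟩
    (s ∸ c) + (s ∸ c)     ∎
  where
  open ≤-Reasoning
  s∸c+c≡s : (s ∸ c) + c ≡ s
  s∸c+c≡s = m∸n+n≡m (≤-trans (m≤m+n c c) 2c≤s)

s²≤4*s′*[s′∸2399] : ∀ s s′ → 5996 ≤ s → s ∸ 599 ≤ s′ → s * s ≤ 4 * (s′ * (s′ ∸ 2399))
s²≤4*s′*[s′∸2399] s s′ 5996≤s s∸599≤s′ = begin
    s * s
  ≤⟨ *-mono-≤ s≤2s′ s≤2[s′∸2399] ⟩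
    (s′ + s′) * ((s′ ∸ 2399) + (s′ ∸ 2399))
  ≡⟨ four s′ (s′ ∸ 2399) ⟩
    4 * (s′ * (s′ ∸ 2399))
  ∎
  where
  open ≤-Reasoning
  four : ∀ a b → (a + a) * (b + b) ≡ 4 * (a * b)
  four = solve-∀
  s≤2s′ : s ≤ s′ + s′
  s≤2s′ = ≤-trans (s≤2*[s∸c] s 599 (≤-trans (≤ᵇ⇒≤ 1198 5996 _) 5996≤s)) (+-mono-≤ s∸599≤s′ s∸599≤s′)
  s∸2998≤s′∸2399 : s ∸ 2998 ≤ s′ ∸ 2399
  s∸2998≤s′∸2399 = subst (_≤ s′ ∸ 2399) (∸-+-assoc s 599 2399) (∸-monoˡ-≤ 2399 s∸599≤s′)
  s≤2[s′∸2399] : s ≤ (s′ ∸ 2399) + (s′ ∸ 2399)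
  s≤2[s′∸2399] = ≤-trans (s≤2*[s∸c] s 2998 5996≤s) (+-mono-≤ s∸2998≤s′∸2399 s∸2998≤s′∸2399)

d²≤2¹⁸*M*N*[j+7]² : ∀ d n j s M N → d ≤ 256 * n → 9 * n ≤ (j + 5) * s → s * s ≤ 4 * (M * N) →
  d * d ≤ (262144 * M) * N * ((j + 7) * (j + 7))
d²≤2¹⁸*M*N*[j+7]² d n j s M N d≤256n 9n≤[j+5]s s²≤4MN = begin
    d * d
  ≤⟨ *-mono-≤ d≤256n d≤256n ⟩
    (256 * n) * (256 * n)
  ≡⟨ square-* 256 n ⟩
    65536 * (n * n)
  ≤⟨ *-monoʳ-≤ 65536 (m≤n*m (n * n) 81) ⟩
    65536 * (81 * (n * n))
  ≡⟨ cong (65536 *_) (square-* 9 n) ⟨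
    65536 * ((9 * n) * (9 * n))
  ≤⟨ *-monoʳ-≤ 65536 (*-mono-≤ 9n≤[j+5]s 9n≤[j+5]s) ⟩
    65536 * (((j + 5) * s) * ((j + 5) * s))
  ≡⟨ cong (65536 *_) (square-* (j + 5) s) ⟩
    65536 * (((j + 5) * (j + 5)) * (s * s))
  ≤⟨ *-monoʳ-≤ 65536 (*-mono-≤ (*-mono-≤ j+5≤j+7 j+5≤j+7) s²≤4MN) ⟩
    65536 * (((j + 7) * (j + 7)) * (4 * (M * N)))
  ≡⟨ regroup (j + 7) M N 65536 ⟩
    (262144 * M) * N * ((j + 7) * (j + 7))
  ∎
  where
  open ≤-Reasoning
  square-* : ∀ a n → (a * n) * (a * n) ≡ (a * a) * (n * n)
  square-* = solve-∀
  regroup : ∀ x M N c → c * ((x * x) * (4 * (M * N))) ≡ (c * 4 * M) * N * (x * x)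
  regroup = solve-∀
  j+5≤j+7 : j + 5 ≤ j + 7
  j+5≤j+7 = +-monoʳ-≤ j (≤ᵇ⇒≤ 5 7 _)

9*2^j≤[j+5]*π : ∀ j → 12 ≤ j → 9 * 2 ^ j ≤ (j + 5) * π (2 ^ j) (32 * 2 ^ j)
9*2^j≤[j+5]*π j 12≤j = subst₂ (λ t w → 9 * 2 ^ t ≤ (t + 5) * π (2 ^ t) w) a+a+r≡j 2^[j+5]≡
                          (chebyshev a r 6≤a (s≤s⁻¹ (m%n<n j 2)))
  where
  a = j / 2
  r = j % 2
  a+a+r≡j : a + a + r ≡ j
  a+a+r≡j = sym (trans (m≡m%n+[m/n]*n j 2) (reorder r a))
    where
    reorder : ∀ r a → r + a * 2 ≡ a + a + r
    reorder = solve-∀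
  2^[j+5]≡ : 2 ^ (a + a + r + 5) ≡ 32 * 2 ^ j
  2^[j+5]≡ = trans (cong (λ t → 2 ^ (t + 5)) a+a+r≡j) (trans (^-distribˡ-+-* 2 j 5) (*-comm (2 ^ j) 32))
  6≤a : 6 ≤ a
  6≤a with 6 ≤? a
  ... | yes 6≤a = 6≤a
  ... | no 6≰a = ⊥-elim (<⇒≱ (s≤s (≤-trans (+-mono-≤ (+-mono-≤ a≤5 a≤5) (s≤s⁻¹ (m%n<n j 2))) ≤-refl))
                               (subst (12 ≤_) (sym a+a+r≡j) 12≤j))
    where
    a≤5 : a ≤ 5
    a≤5 = s≤s⁻¹ (≰⇒> 6≰a)

5996≤π : ∀ j → 14 ≤ j → 5996 ≤ π (2 ^ j) (32 * 2 ^ j)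
5996≤π j 14≤j with 5996 ≤? π (2 ^ j) (32 * 2 ^ j)
... | yes 5996≤ = 5996≤
... | no 5996≰ = ⊥-elim (<⇒≱ (≤-<-trans (9*2^j≤[j+5]*π j (≤-trans (≤ᵇ⇒≤ 12 14 _) 14≤j))
                                (*-monoʳ-< (j + 5) {{>-nonZero (≤-trans (s≤s z≤n) (m≤n+m 5 j))}} (≰⇒> 5996≰)))
                              ([j+5]*c≤9*2^j 5996 (m≤m+n 113924 33532) j 14≤j))

-- 262144 = 4 · 256², from d < 256 n and |S|² ≤ 4 · 2398² · N(d).
K₀ : ℕ
K₀ = 262144 * (2398 * 2398)

-- With n = 2^(⌊log₂ d⌋ − 7), so that 128 n ≤ d < 256 n, the lower-bound configuration applies.
d²≤K₀*N*⌊log₂d⌋² : ∀ d → 2 ^ 21 ≤ d → ∀ (L : List ℕ) → EnumeratesChars d L →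
  d * d ≤ K₀ * length L * (⌊log₂ d ⌋ * ⌊log₂ d ⌋)
d²≤K₀*N*⌊log₂d⌋² d 2²¹≤d L L-enum = subst (λ t → d * d ≤ K₀ * length L * (t * t)) j+7≡lg
  (d²≤2¹⁸*M*N*[j+7]² d n j (π n (32 * n)) (2398 * 2398) (length L)
    (<⇒≤ d<256n) (9*2^j≤[j+5]*π j (≤-trans (≤ᵇ⇒≤ 12 14 _) 14≤j)) |S|²≤4*2398²*N)
  where
  lg = ⌊log₂ d ⌋
  21≤lg : 21 ≤ lg
  21≤lg = 2^m≤n⇒m≤⌊log₂n⌋ 21 d 2²¹≤d
  j = lg ∸ 7
  j+7≡lg : j + 7 ≡ lg
  j+7≡lg = m∸n+n≡m (≤-trans (≤ᵇ⇒≤ 7 21 _) 21≤lg)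
  14≤j : 14 ≤ j
  14≤j = +-cancelʳ-≤ 7 14 j (subst (21 ≤_) (sym j+7≡lg) 21≤lg)
  n = 2 ^ j
  2^lg≡128n : 2 ^ lg ≡ 128 * n
  2^lg≡128n = trans (cong (2 ^_) (sym j+7≡lg)) (trans (^-distribˡ-+-* 2 j 7) (*-comm n 128))
  d<256n : d < 256 * n
  d<256n = subst (d <_) (trans (cong (2 *_) 2^lg≡128n) (sym (*-assoc 2 128 n))) (n<2^[1+⌊log₂n⌋] d)
  64n≤d : 64 * n ≤ d
  64n≤d = ≤-trans (*-monoˡ-≤ n (≤ᵇ⇒≤ 64 128 _))
                  (subst (_≤ d) 2^lg≡128n (2^⌊log₂n⌋≤n d (≤-trans (m^n>0 2 21) 2²¹≤d)))
  open LowerBound d n (^-monoʳ-≤ 2 {1} {j} (≤-trans (s≤s z≤n) 14≤j)) 64n≤d d<256n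
  |S|²≤4*2398²*N : length S * length S ≤ 4 * ((2398 * 2398) * length L)
  |S|²≤4*2398²*N = ≤-trans (s²≤4*s′*[s′∸2399] _ _ (5996≤π j 14≤j) |S|∸599≤|S′|)
    (*-monoʳ-≤ 4 (≤-trans |S′|*[|S′|∸2399]≤|goodPairs| (|goodPairs|≤2398²*|L| L L-enum)))

lemma1 : (∃[ C ] ∃[ d₀ ] ∀ d → d₀ ≤ d → ∀ (L : List ℕ) → EnumeratesChars d L →
              length L ≤ C * (d * d))
           × (∃[ K ] ∃[ d₀ ] ∀ d → d₀ ≤ d → ∀ (L : List ℕ) → EnumeratesChars d L →
              d * d ≤ K * length L * (⌊log₂ d ⌋ * ⌊log₂ d ⌋))
lemma1 = (12 , 1 , N≤12d²) , (K₀ , 2 ^ 21 , d²≤K₀*N*⌊log₂d⌋²)
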